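{- Let $(G_x,\mathrm{lab}_x)=\eta_{i,j}(G_y,\mathrm{lab}_y)$ for labels $i\ne j\in[k]$, where $G_y$ is a non-empty graph with at most $n$ vertices containing no vertex $v$ with $\{i,j\}\subseteq\mathrm{lab}_y(v)$. Then $\mathrm{aux}(G_y,\mathrm{lab}_y)+(n-1)\cdot\{i,j\}=\mathrm{aux}(G_x,\mathrm{lab}_x)$. Moreover, let $\mathcal{A}_y\subseteq\mathrm{aux}(G_y,\mathrm{lab}_y)$ satisfy $\mathcal{A}_y\lesssim\mathrm{aux}(G_y,\mathrm{lab}_y)$, let $\mathcal{A}^0_x=\mathcal{A}_y$ and $\mathcal{A}^{q+1}_x=\mathrm{reduce}(\mathcal{A}^q_x+\{i,j\})$ for $q\in[n-2]_0$, and let $\mathcal{A}_x=\mathcal{A}^{n-1}_x$. Then $\mathcal{A}_x\subseteq\mathrm{aux}(G_x,\mathrm{lab}_x)$ and $\mathcal{A}_x\lesssim\mathrm{aux}(G_x,\mathrm{lab}_x)$.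
   Context: Here $n$ is the number of vertices of a fixed graph $G$ given with a multi-$k$-expression, and $(G_y,\mathrm{lab}_y)$ is a multi-$k$-labeled graph produced by a subexpression (so $|V(G_y)|\le n$). A multi-$k$-labeled graph is $(H,\mathrm{lab})$ with $\mathrm{lab}:V(H)\to2^{[k]}$; $\eta_{i,j}$ adds all edges $uv$ with $i\in\mathrm{lab}(u)$, $j\in\mathrm{lab}(v)$, keeping labels. A path packing of $H$ is a set of vertex-disjoint paths (possibly of length 0) covering all vertices of $H$. A label choice of a path packing $\mathcal{P}$ is a map $\phi:\mathcal{P}\to\binom{[k]}{1}\cup\binom{[k]}{2}$ such that for each path $P$ with endpoints $u,v$ ($u=v$ iff $P$ has length 0), writing $\phi(P)=\{a,b\}$ (possibly $a=b$), we have $a\in\mathrm{lab}(u),b\in\mathrm{lab}(v)$ or $a\in\mathrm{lab}(v),b\in\mathrm{lab}(u)$. Multigraphs here have vertex set $[k]$, may have loops and parallel edges (edges have identifiers); two are equal if all pairs $\{a,b\}$ have equal multiplicities; a loop contributes 2 to the degree. $\mathrm{aux}(\mathcal{P},\phi)$ is the red multigraph with multiplicity of $\{a,b\}$ equal to $|\phi^{ -1}(\{a,b\})|$; $\mathrm{aux}(H,\mathrm{lab})$ is the set of all of them. For a red multigraph $A$, $A+\{i,j\}$ is the family consisting of $A$ together with every multigraph obtained from $A$ by choosing two distinct edges with endpoint sets $\{a,i\}$ and $\{b,j\}$ (any $a,b\in[k]$; loops allowed), removing them, and adding a new edge with endpoints $\{a,b\}$. For a family $\mathcal{A}$: $\mathcal{A}+\{i,j\}=\bigcup_{A\in\mathcal{A}}(A+\{i,j\})$,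 $\mathcal{A}+0\cdot\{i,j\}=\mathcal{A}$, $\mathcal{A}+q\cdot\{i,j\}=(\mathcal{A}+(q-1)\cdot\{i,j\})+\{i,j\}$. Write $A\simeq B$ if $\deg_A(\ell)=\deg_B(\ell)$ for all $\ell\in[k]$ and $A,B$ have the same set of connected components (classes of vertex sets of $[k]$ under connectivity); $\mathrm{reduce}(\mathcal{A})$ is any subset of $\mathcal{A}$ containing exactly one element from each $\simeq$-class of $\mathcal{A}$. $A\uplus B$ adds multiplicities. For a multigraph with red and blue edges and at least one edge, a red-blue Eulerian trail is a closed walk traversing every edge exactly once with alternating colors (first and last edges of different colors). $\mathcal{A}\lesssim\mathcal{B}$ means: for every blue multigraph $M$ on $[k]$, if some $B\in\mathcal{B}$ makes $B\uplus M$ admit a red-blue Eulerian trail, then some $A\in\mathcal{A}$ makes $A\uplus M$ admit one. -}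

module Defs where

open import Level using (0ℓ)
open import Data.Nat using (ℕ; zero; suc; _+_; _∸_; _≤_; _<_)
open import Data.Bool using (Bool; true; false; _∧_; _∨_)
open import Data.Fin using (Fin; _≟_)
open import Data.Fin.Subset using (Subset; _∈_)
open import Data.List using (List; []; _∷_; _++_; map; concat; allFin)
open import Data.List.NonEmpty using (List⁺; toList; head; last)
open import Data.List.Relation.Unary.All using (All)
open import Data.List.Relation.Unary.Linked using (Linked)
open import Data.List.Relation.Binary.Pointwise using (Pointwise)
open import Data.List.Relation.Binary.Permutation.Propositional using (_↭_)
import Data.List.Membership.Propositional as Mem
open import Data.Product using (Σ; ∃; ∃-syntax; _×_; _,_)
open import Data.Sum using (_⊎_)
open import Data.Empty using (⊥)
open import Relation.Nullary using (¬_)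
open import Relation.Nullary.Decidable using (⌊_⌋)
open import Relation.Binary.PropositionalEquality using (_≡_; _≢_)

record LGraph (k : ℕ) : Set₁ where
  field
    m     : ℕ
    E     : Fin m → Fin m → Set
    E-sym : ∀ {u v} → E u v → E v u
    E-irr : ∀ {u} → ¬ E u u
    lab   : Fin m → Subset k
open LGraph public

η : ∀ {k} → Fin k → Fin k → LGraph k → LGraph k
η {k} i j G = record
  { m = m G ; E = E′ ; E-sym = sym′ ; E-irr = irr′ ; lab = lab G }
  where
  New : Fin (m G) → Fin (m G) → Set
  New u v = (i ∈ lab G u × j ∈ lab G v) ⊎ (i ∈ lab G v × j ∈ lab G u)
  E′ : Fin (m G) → Fin (m G) → Set
  E′ u v = E G u v ⊎ (u ≢ v × New u v)
  sym′ : ∀ {u v} → E′ u v → E′ v u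
  sym′ (_⊎_.inj₁ e) = _⊎_.inj₁ (E-sym G e)
  sym′ (_⊎_.inj₂ (u≢v , _⊎_.inj₁ (a , b))) =
    _⊎_.inj₂ ((λ eq → u≢v (Relation.Binary.PropositionalEquality.sym eq)) , _⊎_.inj₂ (a , b))
  sym′ (_⊎_.inj₂ (u≢v , _⊎_.inj₂ (a , b))) =
    _⊎_.inj₂ ((λ eq → u≢v (Relation.Binary.PropositionalEquality.sym eq)) , _⊎_.inj₁ (a , b))
  irr′ : ∀ {u} → ¬ E′ u u
  irr′ (_⊎_.inj₁ e) = E-irr G e
  irr′ (_⊎_.inj₂ (u≢u , _)) = u≢u Relation.Binary.PropositionalEquality.refl

IsPath : ∀ {k} (G : LGraph k) → List⁺ (Fin (m G)) → Set
IsPath G p = Linked (E G) (toList p)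

-- vertex-disjoint paths covering all vertices (vertices also distinct
-- within each path): the concatenated vertex lists form a permutation of V
IsPathPacking : ∀ {k} (G : LGraph k) → List (List⁺ (Fin (m G))) → Set
IsPathPacking G ps =
  All (IsPath G) ps × (concat (map toList ps) ↭ allFin (m G))

-- φ(P) = {a,b} stored as a pair (a , b), with the paper's condition
LabelOK : ∀ {k} (G : LGraph k) → List⁺ (Fin (m G)) → Fin k × Fin k → Set
LabelOK G p (a , b) =
  (a ∈ lab G (head p) × b ∈ lab G (last p)) ⊎
  (a ∈ lab G (last p) × b ∈ lab G (head p))

IsLabelChoice : ∀ {k} (G : LGraph k) → List (List⁺ (Fin (m G))) →
                List (Fin k × Fin k) → Set
IsLabelChoice G ps φ = Pointwise (LabelOK G) ps φ

-- Multigraphs on [k]: list of edges (each edge = endpoint pair; list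
-- positions are the identifiers); loops and parallel edges allowed.

MG : ℕ → Set
MG k = List (Fin k × Fin k)

_==_ : ∀ {k} → Fin k → Fin k → Bool
x == y = ⌊ x ≟ y ⌋

HasEnds : ∀ {k} → Fin k × Fin k → Fin k → Fin k → Set
HasEnds (x , y) a b = (x ≡ a × y ≡ b) ⊎ (x ≡ b × y ≡ a)

hasEnds? : ∀ {k} → Fin k × Fin k → Fin k → Fin k → Bool
hasEnds? (x , y) a b = (x == a ∧ y == b) ∨ (x == b ∧ y == a)

mult : ∀ {k} → MG k → Fin k → Fin k → ℕ
mult [] a b = 0
mult (e ∷ A) a b with hasEnds? e a b
... | true  = suc (mult A a b)
... | false = mult A a b

_≈_ : ∀ {k} → MG k → MG k → Set
A ≈ B = ∀ a b → mult A a b ≡ mult B a b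

-- degree (a loop contributes 2)
deg : ∀ {k} → MG k → Fin k → ℕ
deg [] ℓ = 0
deg ((x , y) ∷ A) ℓ = c x + c y + deg A ℓ
  where
  c : _ → ℕ
  c z with z == ℓ
  ... | true  = 1
  ... | false = 0

data Conn {k} (A : MG k) : Fin k → Fin k → Set where
  here : ∀ {x} → Conn A x x
  step : ∀ {x y z} (e : Fin k × Fin k) → e Mem.∈ A → HasEnds e x y →
         Conn A y z → Conn A x z

SameComponents : ∀ {k} → MG k → MG k → Set
SameComponents A B =
  ∀ x y → (Conn A x y → Conn B x y) × (Conn B x y → Conn A x y)

_≃_ : ∀ {k} → MG k → MG k → Set
A ≃ B = (∀ ℓ → deg A ℓ ≡ deg B ℓ) × SameComponents A B

-- Families of multigraphs (sets, membership understood up to ≈)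

Fam : ℕ → Set₁
Fam k = MG k → Set

_⊆F_ : ∀ {k} → Fam k → Fam k → Set
𝒜 ⊆F ℬ = ∀ A → 𝒜 A → ∃[ B ] (ℬ B × A ≈ B)

_≡F_ : ∀ {k} → Fam k → Fam k → Set
𝒜 ≡F ℬ = (𝒜 ⊆F ℬ) × (ℬ ⊆F 𝒜)

-- aux(P, φ) is φ read as a multigraph; aux(H, lab) is the set of them
Aux : ∀ {k} → LGraph k → Fam k
Aux G A = ∃[ ps ] (IsPathPacking G ps ×
          ∃[ φ ] (IsLabelChoice G ps φ × φ ≈ A))

PlusOne : ∀ {k} → Fin k → Fin k → MG k → Fam k
PlusOne i j A C =
  C ≈ A ⊎
  ∃[ a ] ∃[ b ] ∃[ e₁ ] ∃[ e₂ ] ∃[ R ]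
    (A ↭ (e₁ ∷ e₂ ∷ R) × HasEnds e₁ a i × HasEnds e₂ b j ×
     C ≈ ((a , b) ∷ R))

PlusF : ∀ {k} → Fin k → Fin k → Fam k → Fam k
PlusF i j 𝒜 C = ∃[ A ] (𝒜 A × PlusOne i j A C)

PlusIter : ∀ {k} → ℕ → Fin k → Fin k → Fam k → Fam k
PlusIter zero    i j 𝒜 = 𝒜
PlusIter (suc q) i j 𝒜 = PlusF i j (PlusIter q i j 𝒜)

-- ℬ is a valid value of reduce(𝒜): a subset of 𝒜 with exactly one
-- element from each ≃-class of 𝒜
IsReduce : ∀ {k} → Fam k → Fam k → Set
IsReduce 𝒜 ℬ =
  (ℬ ⊆F 𝒜) ×
  (∀ A → 𝒜 A → ∃[ B ] (ℬ B × A ≃ B)) ×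
  (∀ B B′ → ℬ B → ℬ B′ → B ≃ B′ → B ≈ B′)

data Color : Set where
  red blue : Color

CEdge : ℕ → Set
CEdge k = Color × Fin k × Fin k

_⊎MG_ : ∀ {k} → MG k → MG k → List (CEdge k)
A ⊎MG M = map (red ,_) A ++ map (blue ,_) M

Uses : ∀ {k} → CEdge k → CEdge k → Set
Uses (c , x , y) (c′ , u , v) = c ≡ c′ × HasEnds (x , y) u v

NextStep : ∀ {k} → CEdge k → CEdge k → Set
NextStep (c , x , y) (c′ , x′ , y′) = y ≡ x′ × c ≢ c′

-- closed walk t₀ t₁ … t_L (cyclically linked, incl. last→first),
-- traversing every edge of the multigraph exactly once
IsRBEulerTrail : ∀ {k} → List (CEdge k) → CEdge k → List (CEdge k) → Set
IsRBEulerTrail edges t₀ ts =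
  Linked NextStep ((t₀ ∷ ts) ++ (t₀ ∷ [])) ×
  ∃[ es ] (Pointwise Uses (t₀ ∷ ts) es × es ↭ edges)

HasRBEulerTrail : ∀ {k} → List (CEdge k) → Set
HasRBEulerTrail edges = ∃[ t₀ ] ∃[ ts ] IsRBEulerTrail edges t₀ ts

_≲_ : ∀ {k} → Fam k → Fam k → Set
_≲_ {k} 𝒜 ℬ = (M : MG k) →
  (∃[ B ] (ℬ B × HasRBEulerTrail (B ⊎MG M))) →
  ∃[ A ] (𝒜 A × HasRBEulerTrail (A ⊎MG M))

-- A plus-step {i,j} on the auxiliary multigraph of a path packing
-- is realised in η_{i,j}(G) by joining two paths through a new edge between an
-- i-labelled and a j-labelled end.  Conversely, cutting the paths of a packing of
-- η_{i,j}(G) at their new edges gives a packing of G and undoes one plus-step per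
-- cut; a packing of at most n vertices has at most n − 1 edges, and the remaining
-- steps may be identity steps.
--
-- For ≲ the key fact is the red-blue version of Euler's theorem: A ⊎ M has a
-- red-blue Eulerian trail iff it has an edge, all its edges are connected, and
-- every vertex has as many red as blue edge ends.  Hence trails only see the
-- degrees and components of A, so reduce is harmless.  A plus-step commutes with
-- ≲: a trail for C ⊎ M with C ∈ B + {i,j} becomes one for B ⊎ (M + blue {i,j})
-- by subdividing the red edge {a,b} into a–i, i–j, j–b, and a trail through the
-- blue edge {i,j} contracts back to a trail for an element of A + {i,j}.

module Submission where

open import Defs
open import Data.Bool using (Bool; true; false)
open import Data.Fin using (Fin; _≟_)
open import Data.Fin.Subset using (_∈_)
open import Data.List using (List; []; _∷_; _++_; map; filter; [_]; length; initLast; _∷ʳ′_; concat; allFin)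
open import Data.List.Membership.Propositional using () renaming (_∈_ to _∈ₗ_)
open import Data.List.Membership.Propositional.Properties using (∈-∃++; ∈-++⁺ˡ; ∈-++⁺ʳ; ∈-++⁻; ∈-map⁺; ∈-map⁻; ∈-filter⁻)
open import Data.List.NonEmpty using (List⁺; _∷_; toList; head; last; _⁺++⁺_)
open import Data.List.NonEmpty.Properties using (toList-⁺++⁺)
open import Data.List.Properties using (map-++; ++-identityʳ; filter-++; filter-accept; filter-reject; map-∘; ++-assoc; length-++; map-id; length-tabulate)
import Data.List.Relation.Binary.Permutation.Propositional as ↭
open ↭ using (_↭_; refl; prep; swap; ↭-trans; ↭-sym; ↭-refl; module PermutationReasoning; ↭-reflexive; ↭⇒↭ₛ)
open import Data.List.Relation.Binary.Permutation.Propositional.Properties using (∈-resp-↭; map⁺; filter-↭; ++⁺; shift; ∷↭∷ʳ; ++-comm; ↭-length; ++⁺ˡ; ++⁺ʳ; drop-∷; ↭-empty-inv; shifts; All-resp-↭)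
open import Data.List.Relation.Binary.Permutation.Setoid.Properties using (Unique-resp-↭)
open import Data.List.Relation.Binary.Pointwise using (Pointwise; []; _∷_) renaming (++⁺ to Pointwise-++⁺; refl to Pointwise-refl)
open import Data.List.Relation.Unary.All using (All; []; _∷_; lookup) renaming (map to All-map)
import Data.List.Relation.Unary.All.Properties as All
open import Data.List.Relation.Unary.AllPairs using ([]; _∷_)
open import Data.List.Relation.Unary.Any using (here; there)
open import Data.List.Relation.Unary.Linked using (Linked; [-]; _∷_; []) renaming (map to Linked-map)
open import Data.List.Relation.Unary.Unique.Propositional using (Unique)
open import Data.List.Relation.Unary.Unique.Propositional.Properties using (allFin⁺)
open import Data.Nat using (ℕ; zero; suc; _+_; _≤_; _<_; z≤n; s≤s; _∸_)
open import Data.Nat.ListAction using (sum)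
open import Data.Nat.ListAction.Properties using (sum-↭; sum-++)
open import Data.Nat.Properties using (≤-reflexive; +-assoc; +-comm; +-cancelˡ-≡; m≤n+m; m≤m+n; ≤-trans; +-identityʳ; +-commutativeSemigroup; ≤-pred; n≤1+n; ≤-refl; +-suc; <-trans; n<1+n; ∸-monoˡ-≤)
open import Algebra.Properties.CommutativeSemigroup +-commutativeSemigroup using (interchange)
open import Data.Nat.Tactic.RingSolver using (solve-∀)
open import Data.Product using (∃-syntax; _×_; _,_; proj₁; proj₂)
open import Data.Sum using (_⊎_; inj₁; inj₂)
open import Function using (_∘_)
open import Relation.Binary.Definitions using (DecidableEquality)
open import Relation.Binary.PropositionalEquality using (_≡_; _≢_; refl; sym; trans; cong; cong₂; subst; module ≡-Reasoning; setoid)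
open import Relation.Nullary using (¬_; contradiction; yes; no)
open import Relation.Nullary.Decidable using (proof; isYes≗does)
open import Relation.Nullary.Reflects using (Reflects; ofʸ; ofⁿ; _×-reflects_; _⊎-reflects_)

module _ {A : Set} {R : A → A → Set} where

  linked-join : ∀ us {x vs} → Linked R (us ++ [ x ]) → Linked R (x ∷ vs) → Linked R (us ++ x ∷ vs)
  linked-join []            l       l′ = l′
  linked-join (u ∷ [])      (r ∷ _) l′ = r ∷ l′
  linked-join (u ∷ u′ ∷ us) (r ∷ l) l′ = r ∷ linked-join (u′ ∷ us) l l′

  linked-split : ∀ us {x vs} → Linked R (us ++ x ∷ vs) → Linked R (us ++ [ x ]) × Linked R (x ∷ vs)
  linked-split []            l       = [-] , l
  linked-split (u ∷ [])      (r ∷ l) = r ∷ [-] , l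
  linked-split (u ∷ u′ ∷ us) (r ∷ l) with linked-split (u′ ∷ us) l
  ... | l₁ , l₂ = r ∷ l₁ , l₂

  linked-replaceLast : ∀ us {x y} → Linked R (us ++ [ x ]) → (∀ {z} → R z x → R z y) → Linked R (us ++ [ y ])
  linked-replaceLast []            l       f = [-]
  linked-replaceLast (u ∷ [])      (r ∷ _) f = f r ∷ [-]
  linked-replaceLast (u ∷ u′ ∷ us) (r ∷ l) f = r ∷ linked-replaceLast (u′ ∷ us) l f

  linked-replaceHead : ∀ {x y zs} → Linked R (x ∷ zs) → (∀ {z} → R x z → R y z) → Linked R (y ∷ zs)
  linked-replaceHead [-]     f = [-]
  linked-replaceHead (r ∷ l) f = f r ∷ l

  linked-successor : ∀ us {x z} → Linked R (us ++ [ x ]) → z ∈ₗ us → ∃[ w ] (w ∈ₗ us ++ [ x ] × R z w)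
  linked-successor (u ∷ [])      (r ∷ [-]) (here refl) = _ , there (here refl) , r
  linked-successor (u ∷ u′ ∷ us) (r ∷ l)   (here refl) = u′ , there (here refl) , r
  linked-successor (u ∷ u′ ∷ us) (r ∷ l)   (there z∈) with linked-successor (u′ ∷ us) l z∈
  ... | w , w∈ , r′ = w , there w∈ , r′

module _ {A B : Set} {R : A → B → Set} where

  Pointwise-splitˡ : ∀ xs {xs′ ys} → Pointwise R (xs ++ xs′) ys →
    ∃[ ys₁ ] ∃[ ys₂ ] (ys ≡ ys₁ ++ ys₂ × Pointwise R xs ys₁ × Pointwise R xs′ ys₂)
  Pointwise-splitˡ []       pw      = [] , _ , refl , [] , pw
  Pointwise-splitˡ (x ∷ xs) (r ∷ pw) with Pointwise-splitˡ xs pw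
  ... | ys₁ , ys₂ , refl , pw₁ , pw₂ = _ ∷ ys₁ , ys₂ , refl , r ∷ pw₁ , pw₂

  Pointwise-splitʳ : ∀ ys {ys′ xs} → Pointwise R xs (ys ++ ys′) →
    ∃[ xs₁ ] ∃[ xs₂ ] (xs ≡ xs₁ ++ xs₂ × Pointwise R xs₁ ys × Pointwise R xs₂ ys′)
  Pointwise-splitʳ []       pw      = [] , _ , refl , [] , pw
  Pointwise-splitʳ (y ∷ ys) (r ∷ pw) with Pointwise-splitʳ ys pw
  ... | xs₁ , xs₂ , refl , pw₁ , pw₂ = _ ∷ xs₁ , xs₂ , refl , r ∷ pw₁ , pw₂

  Pointwise-∈ˡ : ∀ {xs ys x} → Pointwise R xs ys → x ∈ₗ xs → ∃[ y ] (y ∈ₗ ys × R x y)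
  Pointwise-∈ˡ (r ∷ pw) (here refl) = _ , here refl , r
  Pointwise-∈ˡ (r ∷ pw) (there x∈)  with Pointwise-∈ˡ pw x∈
  ... | y , y∈ , r′ = y , there y∈ , r′

  Pointwise-∈ʳ : ∀ {xs ys y} → Pointwise R xs ys → y ∈ₗ ys → ∃[ x ] (x ∈ₗ xs × R x y)
  Pointwise-∈ʳ (r ∷ pw) (here refl) = _ , here refl , r
  Pointwise-∈ʳ (r ∷ pw) (there y∈)  with Pointwise-∈ʳ pw y∈
  ... | x , x∈ , r′ = x , there x∈ , r′

  Pointwise-↭ : ∀ {xs ys ys′} → Pointwise R xs ys → ys ↭ ys′ → ∃[ xs′ ] (xs ↭ xs′ × Pointwise R xs′ ys′)
  Pointwise-↭ pw refl = _ , ↭-refl , pw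
  Pointwise-↭ (r ∷ pw) (prep y p) with Pointwise-↭ pw p
  ... | xs′ , q , pw′ = _ ∷ xs′ , prep _ q , r ∷ pw′
  Pointwise-↭ (r₁ ∷ r₂ ∷ pw) (swap y₁ y₂ p) with Pointwise-↭ pw p
  ... | xs′ , q , pw′ = _ ∷ _ ∷ xs′ , swap _ _ q , r₂ ∷ r₁ ∷ pw′
  Pointwise-↭ pw (↭.trans p p′) with Pointwise-↭ pw p
  ... | xs₁ , q₁ , pw₁ with Pointwise-↭ pw₁ p′
  ...   | xs₂ , q₂ , pw₂ = xs₂ , ↭-trans q₁ q₂ , pw₂

module _ {A : Set} where

  ∈⇒↭ : ∀ {x : A} {xs} → x ∈ₗ xs → ∃[ ys ] (xs ↭ x ∷ ys)
  ∈⇒↭ {x} x∈ with ∈-∃++ x∈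
  ... | us , vs , refl = us ++ vs , shift x us vs

  Unique-++-≢ : ∀ (xs : List A) {ys : List A} {x y : A} → Unique (xs ++ ys) → x ∈ₗ xs → y ∈ₗ ys → x ≢ y
  Unique-++-≢ (z ∷ xs) (z∉ ∷ _) (here refl) y∈ = lookup z∉ (∈-++⁺ʳ xs y∈)
  Unique-++-≢ (z ∷ xs) (_ ∷ u)  (there x∈)  y∈ = Unique-++-≢ xs u x∈ y∈

  Unique-↭ : ∀ {xs ys : List A} → xs ↭ ys → Unique xs → Unique ys
  Unique-↭ p = Unique-resp-↭ (setoid A) (↭⇒↭ₛ p)

Edge : ℕ → Set
Edge k = Fin k × Fin k

private variable
  k : ℕ
  a b i j p q v w x y z ℓ : Fin k
  c : Color
  e f g : Edge k
  A A′ B C M M′ R : MG k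
  s t h s₁ s₂ : CEdge k
  ts es L L′ Rest : List (CEdge k)
  𝒜 ℬ 𝒞 : Fam k

HasEnds-sym : HasEnds e a b → HasEnds e b a
HasEnds-sym (inj₁ (p , q)) = inj₂ (p , q)
HasEnds-sym (inj₂ (p , q)) = inj₁ (p , q)

HasEnds-flip : HasEnds (y , x) a b → HasEnds (x , y) a b
HasEnds-flip (inj₁ (p , q)) = inj₂ (q , p)
HasEnds-flip (inj₂ (p , q)) = inj₁ (q , p)

HasEnds-trans : HasEnds e a b → HasEnds (a , b) x y → HasEnds e x y
HasEnds-trans (inj₁ (refl , refl)) h = h
HasEnds-trans (inj₂ (refl , refl)) h = HasEnds-flip h

HasEnds-cotrans : HasEnds e a b → HasEnds e x y → HasEnds (a , b) x y
HasEnds-cotrans (inj₁ (refl , refl)) h = h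
HasEnds-cotrans (inj₂ (refl , refl)) h = HasEnds-flip h

==-reflects : ∀ (x y : Fin k) → Reflects (x ≡ y) (x == y)
==-reflects x y = subst (Reflects _) (sym (isYes≗does (x ≟ y))) (proof (x ≟ y))

hasEnds-reflects : ∀ (e : Edge k) a b → Reflects (HasEnds e a b) (hasEnds? e a b)
hasEnds-reflects (x , y) a b =
  (==-reflects x a ×-reflects ==-reflects y b) ⊎-reflects (==-reflects x b ×-reflects ==-reflects y a)

hasEnds?-resp : HasEnds e a b → ∀ x y → hasEnds? e x y ≡ hasEnds? (a , b) x y
hasEnds?-resp {e = e} {a} {b} h x y
  with hasEnds? e x y | hasEnds-reflects e x y | hasEnds? (a , b) x y | hasEnds-reflects (a , b) x y
... | true  | _       | true  | _       = refl
... | false | _       | false | _       = refl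
... | true  | ofʸ h′  | false | ofⁿ ¬h′ = contradiction (HasEnds-cotrans h h′) ¬h′
... | false | ofⁿ ¬h′ | true  | ofʸ h′  = contradiction (HasEnds-trans h h′) ¬h′

χ : Bool → ℕ
χ true  = 1
χ false = 0

δ : Fin k → Fin k → ℕ
δ x ℓ = χ (x == ℓ)

δ-refl : ∀ (x : Fin k) → δ x x ≡ 1
δ-refl x with x == x | ==-reflects x x
... | true  | _      = refl
... | false | ofⁿ ¬p = contradiction refl ¬p

δ-≢ : x ≢ ℓ → δ x ℓ ≡ 0
δ-≢ {x = x} {ℓ} x≢ℓ with x == ℓ | ==-reflects x ℓ
... | false | _     = refl
... | true  | ofʸ p = contradiction p x≢ℓ

χ-hasEnds : HasEnds e a b → χ (hasEnds? e a b) ≡ 1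
χ-hasEnds {e = e} {a} {b} h with hasEnds? e a b | hasEnds-reflects e a b
... | true  | _      = refl
... | false | ofⁿ ¬h = contradiction h ¬h

mult-∷ : ∀ e (A : MG k) a b → mult (e ∷ A) a b ≡ χ (hasEnds? e a b) + mult A a b
mult-∷ e A a b with hasEnds? e a b
... | true  = refl
... | false = refl

mult≡sum : ∀ (A : MG k) a b → mult A a b ≡ sum (map (λ e → χ (hasEnds? e a b)) A)
mult≡sum []      a b = refl
mult≡sum (e ∷ A) a b = trans (mult-∷ e A a b) (cong (χ (hasEnds? e a b) +_) (mult≡sum A a b))

-- A record around _≈_, so that the two multigraphs can be inferred from a proof.
infix 4 _≋_

record _≋_ (A B : MG k) : Set where
  constructor mk≋
  field ≋⇒≈ : A ≈ B
open _≋_ public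

↭⇒≋ : A ↭ B → A ≋ B
↭⇒≋ {A = A} {B} p = mk≋ λ a b →
  trans (mult≡sum A a b) (trans (sum-↭ (map⁺ _ p)) (sym (mult≡sum B a b)))

≋-refl : A ≋ A
≋-refl = mk≋ λ a b → refl

≋-sym : A ≋ B → B ≋ A
≋-sym (mk≋ p) = mk≋ λ a b → sym (p a b)

≋-trans : A ≋ B → B ≋ R → A ≋ R
≋-trans (mk≋ p) (mk≋ q) = mk≋ λ a b → trans (p a b) (q a b)

≋-∷ : ∀ e → A ≋ B → (e ∷ A) ≋ (e ∷ B)
≋-∷ {A = A} {B} e (mk≋ p) = mk≋ λ a b →
  trans (mult-∷ e A a b) (trans (cong (χ (hasEnds? e a b) +_) (p a b)) (sym (mult-∷ e B a b)))

HasEnds⇒≋ : HasEnds e a b → (e ∷ A) ≋ ((a , b) ∷ A)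
HasEnds⇒≋ {e = e} {a} {b} {A} h = mk≋ λ x y →
  trans (mult-∷ e A x y) (trans (cong (λ t → χ t + mult A x y) (hasEnds?-resp h x y))
    (sym (mult-∷ (a , b) A x y)))

≋-cancel : HasEnds e a b → (e ∷ A) ≋ ((a , b) ∷ B) → A ≋ B
≋-cancel {e = e} {a} {b} {A} {B} h (mk≋ p) = mk≋ λ x y →
  +-cancelˡ-≡ (χ (hasEnds? e x y)) _ _ (begin
    χ (hasEnds? e x y) + mult A x y       ≡⟨ sym (mult-∷ e A x y) ⟩
    mult (e ∷ A) x y                      ≡⟨ p x y ⟩
    mult ((a , b) ∷ B) x y                ≡⟨ mult-∷ (a , b) B x y ⟩
    χ (hasEnds? (a , b) x y) + mult B x y ≡⟨ cong (λ t → χ t + mult B x y) (sym (hasEnds?-resp h x y)) ⟩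
    χ (hasEnds? e x y) + mult B x y       ∎)
  where open ≡-Reasoning

mult-pos : e ∈ₗ A → HasEnds e a b → 1 ≤ mult A a b
mult-pos {e = e} {A = .e ∷ A} {a} {b} (here refl) h =
  subst (1 ≤_) (sym (trans (mult-∷ e A a b) (cong (_+ mult A a b) (χ-hasEnds h)))) (s≤s z≤n)
mult-pos {A = f ∷ A} {a} {b} (there e∈A) h =
  subst (1 ≤_) (sym (mult-∷ f A a b)) (≤-trans (mult-pos e∈A h) (m≤n+m _ _))

mult-head : ∀ a b (A : MG k) → 1 ≤ mult ((a , b) ∷ A) a b
mult-head a b A = mult-pos {A = (a , b) ∷ A} (here refl) (inj₁ (refl , refl))

mult-pos⇒↭ : ∀ (A : MG k) a b → 1 ≤ mult A a b → ∃[ e ] ∃[ R ] (A ↭ e ∷ R × HasEnds e a b)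
mult-pos⇒↭ (e ∷ A) a b p with hasEnds? e a b | hasEnds-reflects e a b
... | true  | ofʸ h = e , A , refl , h
... | false | _ with mult-pos⇒↭ A a b p
...   | f , R , q , h = f , e ∷ R , ↭-trans (prep e q) (swap e f refl) , h

≋-uncons : A ≋ ((a , b) ∷ B) → ∃[ e ] ∃[ R ] (A ↭ e ∷ R × HasEnds e a b × R ≋ B)
≋-uncons {A = A} {a} {b} {B} A≋ab∷B
  with mult-pos⇒↭ A a b (subst (1 ≤_) (sym (≋⇒≈ A≋ab∷B a b)) (mult-head a b B))
... | e , R , q , h = e , R , q , h , ≋-cancel h (≋-trans (≋-sym (↭⇒≋ q)) A≋ab∷B)

≋-∈ : A ≋ B → e ∈ₗ A → ∃[ f ] (f ∈ₗ B × HasEnds f (proj₁ e) (proj₂ e))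
≋-∈ {A = A} {B} {e} (mk≋ p) e∈A
  with mult-pos⇒↭ B (proj₁ e) (proj₂ e) (subst (1 ≤_) (p _ _) (mult-pos e∈A (inj₁ (refl , refl))))
... | f , R , q , h = f , ∈-resp-↭ (↭-sym q) (here refl) , h

endsAt : Edge k → Fin k → ℕ
endsAt (x , y) ℓ = δ x ℓ + δ y ℓ

endsAt-resp : HasEnds e a b → ∀ ℓ → endsAt e ℓ ≡ endsAt (a , b) ℓ
endsAt-resp (inj₁ (refl , refl)) ℓ = refl
endsAt-resp {a = a} (inj₂ (refl , refl)) ℓ = +-comm _ (δ a ℓ)

deg-∷ : ∀ e (A : MG k) ℓ → deg (e ∷ A) ℓ ≡ endsAt e ℓ + deg A ℓ
deg-∷ (x , y) A ℓ with x == ℓ | y == ℓ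
... | true  | true  = refl
... | true  | false = refl
... | false | true  = refl
... | false | false = refl

deg≡sum : ∀ (A : MG k) ℓ → deg A ℓ ≡ sum (map (λ e → endsAt e ℓ) A)
deg≡sum []      ℓ = refl
deg≡sum (e ∷ A) ℓ = trans (deg-∷ e A ℓ) (cong (endsAt e ℓ +_) (deg≡sum A ℓ))

deg-↭ : A ↭ B → ∀ ℓ → deg A ℓ ≡ deg B ℓ
deg-↭ {A = A} {B} p ℓ = trans (deg≡sum A ℓ) (trans (sum-↭ (map⁺ _ p)) (sym (deg≡sum B ℓ)))

deg-++ : ∀ (A B : MG k) ℓ → deg (A ++ B) ℓ ≡ deg A ℓ + deg B ℓ
deg-++ A B ℓ = begin
  deg (A ++ B) ℓ                                             ≡⟨ deg≡sum (A ++ B) ℓ ⟩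
  sum (map (λ e → endsAt e ℓ) (A ++ B))                      ≡⟨ cong sum (map-++ _ A B) ⟩
  sum (map (λ e → endsAt e ℓ) A ++ map (λ e → endsAt e ℓ) B) ≡⟨ sum-++ (map _ A) _ ⟩
  sum (map (λ e → endsAt e ℓ) A) + sum (map (λ e → endsAt e ℓ) B)
    ≡⟨ sym (cong₂ _+_ (deg≡sum A ℓ) (deg≡sum B ℓ)) ⟩
  deg A ℓ + deg B ℓ                                          ∎
  where open ≡-Reasoning

≋⇒deg : A ≋ B → ∀ ℓ → deg A ℓ ≡ deg B ℓ
≋⇒deg {A = []} {[]} p ℓ = refl
≋⇒deg {A = []} {e ∷ B} (mk≋ p) ℓ
  with () ← subst (1 ≤_) (sym (p _ _)) (mult-head (proj₁ e) (proj₂ e) B)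
≋⇒deg {A = (a , b) ∷ A} {B} p ℓ with ≋-uncons (≋-sym p)
... | e , R , q , h , R≋A = begin
  deg ((a , b) ∷ A) ℓ       ≡⟨ deg-∷ (a , b) A ℓ ⟩
  endsAt (a , b) ℓ + deg A ℓ ≡⟨ cong₂ _+_ (sym (endsAt-resp h ℓ)) (≋⇒deg (≋-sym R≋A) ℓ) ⟩
  endsAt e ℓ + deg R ℓ       ≡⟨ sym (deg-∷ e R ℓ) ⟩
  deg (e ∷ R) ℓ              ≡⟨ sym (deg-↭ q ℓ) ⟩
  deg B ℓ                    ∎
  where open ≡-Reasoning

Incident : Edge k → Fin k → Set
Incident (x , y) v = x ≡ v ⊎ y ≡ v

HasEnds⇒Incident : HasEnds e a b → Incident e a
HasEnds⇒Incident (inj₁ (p , _)) = inj₁ p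
HasEnds⇒Incident (inj₂ (_ , q)) = inj₂ q

Incident⇒HasEnds : Incident e v → ∃[ w ] HasEnds e v w
Incident⇒HasEnds {e = x , y} (inj₁ p) = y , inj₁ (p , refl)
Incident⇒HasEnds {e = x , y} (inj₂ q) = x , inj₂ (refl , q)

HasEnds-incident : HasEnds e a b → Incident e v → v ≡ a ⊎ v ≡ b
HasEnds-incident {e = x , y} (inj₁ (refl , refl)) (inj₁ refl) = inj₁ refl
HasEnds-incident {e = x , y} (inj₁ (refl , refl)) (inj₂ refl) = inj₂ refl
HasEnds-incident {e = x , y} (inj₂ (refl , refl)) (inj₁ refl) = inj₂ refl
HasEnds-incident {e = x , y} (inj₂ (refl , refl)) (inj₂ refl) = inj₁ refl

incident⇒deg-pos : e ∈ₗ A → Incident e v → 1 ≤ deg A v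
incident⇒deg-pos {e = e} {A = .e ∷ A} {v} (here refl) i with Incident⇒HasEnds i
... | w , h = subst (1 ≤_) (sym (deg-∷ e A v)) (≤-trans (endsAt-pos h) (m≤m+n _ _))
  where
  endsAt-pos : HasEnds e v w → 1 ≤ endsAt e v
  endsAt-pos h = subst (1 ≤_) (sym (trans (endsAt-resp h v) (cong (_+ δ w v) (δ-refl v)))) (s≤s z≤n)
incident⇒deg-pos {A = f ∷ A} {v} (there e∈A) i =
  subst (1 ≤_) (sym (deg-∷ f A v)) (≤-trans (incident⇒deg-pos e∈A i) (m≤n+m _ _))

deg-pos⇒incident : ∀ (A : MG k) v → 1 ≤ deg A v → ∃[ e ] (e ∈ₗ A × Incident e v)
deg-pos⇒incident ((x , y) ∷ A) v p with x == v | ==-reflects x v | y == v | ==-reflects y v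
... | true  | ofʸ x≡v | _     | _       = (x , y) , here refl , inj₁ x≡v
... | false | _       | true  | ofʸ y≡v = (x , y) , here refl , inj₂ y≡v
... | false | _       | false | _ with deg-pos⇒incident A v p
...   | e , e∈A , i = e , there e∈A , i

conn-edge : e ∈ₗ A → HasEnds e x y → Conn A x y
conn-edge {e = e} e∈A h = step e e∈A h here

conn-trans : Conn A x y → Conn A y z → Conn A x z
conn-trans here             q = q
conn-trans (step e e∈A h p) q = step e e∈A h (conn-trans p q)

conn-sym : Conn A x y → Conn A y x
conn-sym here             = here
conn-sym (step e e∈A h p) = conn-trans (conn-sym p) (conn-edge e∈A (HasEnds-sym h))

conn-map : (∀ {e} → e ∈ₗ A → Conn B (proj₁ e) (proj₂ e)) → Conn A x y → Conn B x y
conn-map f here                                = here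
conn-map f (step e e∈A (inj₁ (refl , refl)) p) = conn-trans (f e∈A) (conn-map f p)
conn-map f (step e e∈A (inj₂ (refl , refl)) p) = conn-trans (conn-sym (f e∈A)) (conn-map f p)

conn-mono : (∀ {e} → e ∈ₗ A → e ∈ₗ B) → Conn A x y → Conn B x y
conn-mono f = conn-map λ e∈A → conn-edge (f e∈A) (inj₁ (refl , refl))

conn-incident : e ∈ₗ A → Incident e v → Conn A (proj₁ e) v
conn-incident e∈A (inj₁ refl) = here
conn-incident e∈A (inj₂ refl) = conn-edge e∈A (inj₁ (refl , refl))

_≟ᶜ_ : DecidableEquality Color
red  ≟ᶜ red  = yes refl
blue ≟ᶜ blue = yes refl
red  ≟ᶜ blue = no λ ()
blue ≟ᶜ red  = no λ ()

other : Color → Color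
other red  = blue
other blue = red

other-≢ : ∀ c → other c ≢ c
other-≢ red  ()
other-≢ blue ()

other-≢′ : ∀ c → c ≢ other c
other-≢′ c eq = other-≢ c (sym eq)

≢⇒other : ∀ {c c′} → c′ ≢ c → c′ ≡ other c
≢⇒other {red}  {red}  c′≢c = contradiction refl c′≢c
≢⇒other {red}  {blue} _    = refl
≢⇒other {blue} {red}  _    = refl
≢⇒other {blue} {blue} c′≢c = contradiction refl c′≢c

colour : CEdge k → Color
colour (c , _ , _) = c

start end : CEdge k → Fin k
start (_ , x , _) = x
end   (_ , _ , y) = y

Uses⇒HasEnds : Uses s (c , e) → HasEnds e (start s) (end s)
Uses⇒HasEnds {s = _ , _ , _} (_ , h) = HasEnds-cotrans h (inj₁ (refl , refl))

HasEnds⇒Uses : ∀ {g : Edge k} → HasEnds g x y → Uses (c , x , y) (c , g)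
HasEnds⇒Uses h = refl , HasEnds-cotrans h (inj₁ (refl , refl))

Uses-refl : ∀ (s : CEdge k) → Uses s s
Uses-refl (c , x , y) = refl , inj₁ (refl , refl)

ofColour : Color → List (CEdge k) → MG k
ofColour c = map proj₂ ∘ filter (λ s → colour s ≟ᶜ c)

ofColour-↭ : ∀ c → L ↭ L′ → ofColour c L ↭ ofColour c L′
ofColour-↭ c p = map⁺ proj₂ (filter-↭ _ p)

ofColour-here : ∀ c e (L : List (CEdge k)) → ofColour c ((c , e) ∷ L) ≡ e ∷ ofColour c L
ofColour-here c e L = cong (map proj₂) (filter-accept (λ s → colour s ≟ᶜ c) refl)

ofColour-skip : ∀ {c c′} e (L : List (CEdge k)) → c′ ≢ c → ofColour c ((c′ , e) ∷ L) ≡ ofColour c L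
ofColour-skip {c = c} e L c′≢c = cong (map proj₂) (filter-reject (λ s → colour s ≟ᶜ c) c′≢c)

ofColour-++ : ∀ c (L L′ : List (CEdge k)) → ofColour c (L ++ L′) ≡ ofColour c L ++ ofColour c L′
ofColour-++ c L L′ = trans (cong (map proj₂) (filter-++ _ L L′)) (map-++ proj₂ (filter _ L) _)

private
  ofColour-paint : ∀ c (A : MG k) → ofColour c (map (c ,_) A) ≡ A
  ofColour-paint c []      = refl
  ofColour-paint c (e ∷ A) = trans (ofColour-here c e (map (c ,_) A)) (cong (e ∷_) (ofColour-paint c A))

  ofColour-paint-other : ∀ c (A : MG k) → ofColour c (map (other c ,_) A) ≡ []
  ofColour-paint-other c []      = refl
  ofColour-paint-other c (e ∷ A) = trans (ofColour-skip e (map (other c ,_) A) (other-≢ c)) (ofColour-paint-other c A)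

ofColour-red : ∀ (A M : MG k) → ofColour red (A ⊎MG M) ≡ A
ofColour-red A M = begin
  ofColour red (map (red ,_) A ++ map (blue ,_) M)               ≡⟨ ofColour-++ red (map (red ,_) A) _ ⟩
  ofColour red (map (red ,_) A) ++ ofColour red (map (blue ,_) M) ≡⟨ cong₂ _++_ (ofColour-paint red A) (ofColour-paint-other red M) ⟩
  A ++ []                                                        ≡⟨ ++-identityʳ A ⟩
  A                                                              ∎
  where open ≡-Reasoning

ofColour-blue : ∀ (A M : MG k) → ofColour blue (A ⊎MG M) ≡ M
ofColour-blue A M = begin
  ofColour blue (map (red ,_) A ++ map (blue ,_) M)                ≡⟨ ofColour-++ blue (map (red ,_) A) _ ⟩
  ofColour blue (map (red ,_) A) ++ ofColour blue (map (blue ,_) M) ≡⟨ cong₂ _++_ (ofColour-paint-other blue A) (ofColour-paint blue M) ⟩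
  M                                                                ∎
  where open ≡-Reasoning

↭-byColour : ∀ (L : List (CEdge k)) → L ↭ ofColour red L ⊎MG ofColour blue L
↭-byColour [] = ↭-refl
↭-byColour ((red , e) ∷ L) = prep (red , e) (↭-byColour L)
↭-byColour ((blue , e) ∷ L) = ↭-trans (prep (blue , e) (↭-byColour L))
  (↭-sym (shift (blue , e) (map (red ,_) (ofColour red L)) (map (blue ,_) (ofColour blue L))))

⊎MG-↭ : ∀ {A A′ M M′ : MG k} → A ↭ A′ → M ↭ M′ → A ⊎MG M ↭ A′ ⊎MG M′
⊎MG-↭ p q = ++⁺
  (map⁺ (red ,_) p)
  (map⁺ (blue ,_) q)

underlying : List (CEdge k) → MG k
underlying = map proj₂

underlying-⊎MG : ∀ (A M : MG k) → underlying (A ⊎MG M) ≡ A ++ M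
underlying-⊎MG A M = begin
  map proj₂ (map (red ,_) A ++ map (blue ,_) M)             ≡⟨ map-++ proj₂ (map (red ,_) A) _ ⟩
  map proj₂ (map (red ,_) A) ++ map proj₂ (map (blue ,_) M) ≡⟨ cong₂ _++_ (strip red A) (strip blue M) ⟩
  A ++ M                                                    ∎
  where
  open ≡-Reasoning
  strip : ∀ c (A : MG k) → map proj₂ (map (c ,_) A) ≡ A
  strip c A = trans (sym (map-∘ A)) (map-id A)

degᶜ : Color → List (CEdge k) → Fin k → ℕ
degᶜ c L ℓ = deg (ofColour c L) ℓ

degᶜ-↭ : ∀ c → L ↭ L′ → ∀ ℓ → degᶜ c L ℓ ≡ degᶜ c L′ ℓ
degᶜ-↭ c p = deg-↭ (ofColour-↭ c p)

degᶜ-here : ∀ c g (L : List (CEdge k)) ℓ → degᶜ c ((c , g) ∷ L) ℓ ≡ endsAt g ℓ + degᶜ c L ℓ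
degᶜ-here c g L ℓ = trans (cong (λ A → deg A ℓ) (ofColour-here c g L)) (deg-∷ g (ofColour c L) ℓ)

degᶜ-skip : ∀ {c c′} g (L : List (CEdge k)) ℓ → c′ ≢ c → degᶜ c ((c′ , g) ∷ L) ℓ ≡ degᶜ c L ℓ
degᶜ-skip g L ℓ c′≢c = cong (λ A → deg A ℓ) (ofColour-skip g L c′≢c)

degᶜ-++ : ∀ c (L L′ : List (CEdge k)) ℓ → degᶜ c (L ++ L′) ℓ ≡ degᶜ c L ℓ + degᶜ c L′ ℓ
degᶜ-++ c L L′ ℓ = trans (cong (λ A → deg A ℓ) (ofColour-++ c L L′)) (deg-++ (ofColour c L) _ ℓ)

degᶜ-pos⇒↭ : ∀ c ℓ (L : List (CEdge k)) → 1 ≤ degᶜ c L ℓ →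
                ∃[ g ] ∃[ L′ ] (L ↭ (c , g) ∷ L′ × Incident g ℓ)
degᶜ-pos⇒↭ c ℓ L pos with deg-pos⇒incident (ofColour c L) ℓ pos
... | g , g∈ , inc with ∈-map⁻ proj₂ g∈
...   | (c′ , g) , g∈′ , refl with ∈-filter⁻ (λ s → colour s ≟ᶜ c) {xs = L} g∈′
...     | g∈L , refl with ∈⇒↭ g∈L
...       | L′ , p = g , L′ , p , inc

degᶜ-red : ∀ (A M : MG k) ℓ → degᶜ red (A ⊎MG M) ℓ ≡ deg A ℓ
degᶜ-red A M ℓ = cong (λ X → deg X ℓ) (ofColour-red A M)

degᶜ-blue : ∀ (A M : MG k) ℓ → degᶜ blue (A ⊎MG M) ℓ ≡ deg M ℓ
degᶜ-blue A M ℓ = cong (λ X → deg X ℓ) (ofColour-blue A M)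

record Balanced (L : List (CEdge k)) : Set where
  constructor mkBalanced
  field balanced : ∀ ℓ → degᶜ red L ℓ ≡ degᶜ blue L ℓ
open Balanced public

Balanced-↭ : L ↭ L′ → Balanced L → Balanced L′
Balanced-↭ p (mkBalanced bal) = mkBalanced λ ℓ →
  trans (sym (degᶜ-↭ red p ℓ)) (trans (bal ℓ) (degᶜ-↭ blue p ℓ))

Balanced⇒colour : Balanced L → ∀ c ℓ → degᶜ c L ℓ ≡ degᶜ (other c) L ℓ
Balanced⇒colour (mkBalanced bal) red  ℓ = bal ℓ
Balanced⇒colour (mkBalanced bal) blue ℓ = sym (bal ℓ)

colour⇒Balanced : ∀ c → (∀ ℓ → degᶜ c L ℓ ≡ degᶜ (other c) L ℓ) → Balanced L
colour⇒Balanced red  bal = mkBalanced bal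
colour⇒Balanced blue bal = mkBalanced λ ℓ → sym (bal ℓ)

Uses⇒≋ : ∀ {T es : List (CEdge k)} → Pointwise Uses T es → ∀ c → ofColour c T ≋ ofColour c es
Uses⇒≋ []                                       c = ≋-refl
Uses⇒≋ {T = (c′ , x , y) ∷ T} ((refl , h) ∷ pw) c with c′ ≟ᶜ c
... | yes _ = ≋-trans (HasEnds⇒≋ h) (≋-∷ _ (Uses⇒≋ pw c))
... | no  _ = Uses⇒≋ pw c

Balanced-Uses : ∀ {T es : List (CEdge k)} → Pointwise Uses T es → Balanced T → Balanced es
Balanced-Uses pw (mkBalanced bal) = mkBalanced λ ℓ →
  trans (sym (≋⇒deg (Uses⇒≋ pw red) ℓ)) (trans (bal ℓ) (≋⇒deg (Uses⇒≋ pw blue) ℓ))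

Balanced-reorient : ∀ {g : Edge k} → HasEnds g p q → Balanced ((c , g) ∷ L) → Balanced ((c , p , q) ∷ L)
Balanced-reorient {L = L} h = Balanced-Uses ((refl , h) ∷ Pointwise-refl (λ {s} → Uses-refl s))

Balanced-cancel : L ↭ es ++ Rest → Balanced L → Balanced es → Balanced Rest
Balanced-cancel {L = L} {es} {Rest} p (mkBalanced balL) (mkBalanced bales) = mkBalanced λ ℓ →
  +-cancelˡ-≡ (degᶜ red es ℓ) _ _ (begin
    degᶜ red es ℓ + degᶜ red Rest ℓ   ≡⟨ sym (trans (degᶜ-↭ red p ℓ) (degᶜ-++ red es Rest ℓ)) ⟩
    degᶜ red L ℓ                      ≡⟨ balL ℓ ⟩
    degᶜ blue L ℓ                     ≡⟨ trans (degᶜ-↭ blue p ℓ) (degᶜ-++ blue es Rest ℓ) ⟩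
    degᶜ blue es ℓ + degᶜ blue Rest ℓ ≡⟨ cong (_+ degᶜ blue Rest ℓ) (sym (bales ℓ)) ⟩
    degᶜ red es ℓ + degᶜ blue Rest ℓ  ∎)
  where open ≡-Reasoning

ClosedWalk : CEdge k → List (CEdge k) → Set
ClosedWalk t ts = Linked NextStep (t ∷ ts ++ [ t ])

startIn endIn : Color → CEdge k → Fin k → ℕ
startIn c s ℓ with colour s ≟ᶜ c
... | yes _ = δ (start s) ℓ
... | no  _ = 0
endIn c s ℓ with colour s ≟ᶜ c
... | yes _ = δ (end s) ℓ
... | no  _ = 0

startsIn endsIn : Color → List (CEdge k) → Fin k → ℕ
startsIn c L ℓ = sum (map (λ s → startIn c s ℓ) L)
endsIn   c L ℓ = sum (map (λ s → endIn c s ℓ) L)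

visits : List (CEdge k) → Fin k → ℕ
visits L ℓ = sum (map (λ s → δ (end s) ℓ) L)

degᶜ-ends : ∀ c (L : List (CEdge k)) ℓ → degᶜ c L ℓ ≡ startsIn c L ℓ + endsIn c L ℓ
degᶜ-ends c [] ℓ = refl
degᶜ-ends c ((c′ , x , y) ∷ L) ℓ with c′ ≟ᶜ c
... | yes _ = trans (deg-∷ (x , y) (ofColour c L) ℓ)
                (trans (cong (endsAt (x , y) ℓ +_) (degᶜ-ends c L ℓ))
                  (interchange (δ x ℓ) (δ y ℓ) (startsIn c L ℓ) (endsIn c L ℓ)))
... | no  _ = degᶜ-ends c L ℓ

-- Since colours alternate, each junction of two consecutive steps of a walk
-- contributes one edge end of each colour at the common vertex.
junction : ∀ c {s s′ : CEdge k} → NextStep s s′ → endIn c s ℓ + startIn c s′ ℓ ≡ δ (end s) ℓ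
junction c {c₁ , x , y} {c₂ , .y , z} (refl , c₁≢c₂) with c₁ ≟ᶜ c | c₂ ≟ᶜ c
... | yes refl | yes refl = contradiction refl c₁≢c₂
... | yes _    | no  _    = +-identityʳ _
... | no  _    | yes _    = refl
... | no  c₁≢c | no  c₂≢c = contradiction (trans (≢⇒other c₁≢c) (sym (≢⇒other c₂≢c))) c₁≢c₂

walk-junctions : ∀ c {a z : CEdge k} bs → Linked NextStep (a ∷ bs ++ [ z ]) →
                 endsIn c (a ∷ bs) ℓ + startsIn c (bs ++ [ z ]) ℓ ≡ visits (a ∷ bs) ℓ
walk-junctions c {a} {z} [] (r ∷ [-]) =
  trans (interchange (endIn c a _) 0 (startIn c z _) 0) (cong (_+ 0) (junction c r))
walk-junctions c {a} (b ∷ bs) (r ∷ l) =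
  trans (interchange (endIn c a _) (endsIn c (b ∷ bs) _) (startIn c b _) _)
    (cong₂ _+_ (junction c r) (walk-junctions c bs l))

closedWalk-colourDeg : ∀ {t : CEdge k} ts → ClosedWalk t ts → ∀ c ℓ → degᶜ c (t ∷ ts) ℓ ≡ visits (t ∷ ts) ℓ
closedWalk-colourDeg {t = t} ts cw c ℓ = begin
  degᶜ c (t ∷ ts) ℓ                                ≡⟨ degᶜ-ends c (t ∷ ts) ℓ ⟩
  startsIn c (t ∷ ts) ℓ + endsIn c (t ∷ ts) ℓ      ≡⟨ cong (_+ endsIn c (t ∷ ts) ℓ) (sum-↭ (map⁺ _ (∷↭∷ʳ t ts))) ⟩
  startsIn c (ts ++ [ t ]) ℓ + endsIn c (t ∷ ts) ℓ ≡⟨ +-comm (startsIn c (ts ++ [ t ]) ℓ) _ ⟩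
  endsIn c (t ∷ ts) ℓ + startsIn c (ts ++ [ t ]) ℓ ≡⟨ walk-junctions c ts cw ⟩
  visits (t ∷ ts) ℓ                                ∎
  where open ≡-Reasoning

closedWalk-balanced : ∀ {t : CEdge k} ts → ClosedWalk t ts → Balanced (t ∷ ts)
closedWalk-balanced ts cw = mkBalanced λ ℓ →
  trans (closedWalk-colourDeg ts cw red ℓ) (sym (closedWalk-colourDeg ts cw blue ℓ))

ClosedTrail : CEdge k → List (CEdge k) → List (CEdge k) → Set
ClosedTrail t ts es = ClosedWalk t ts × Pointwise Uses (t ∷ ts) es

closedTrail-balanced : ClosedTrail t ts es → Balanced es
closedTrail-balanced {ts = ts} (cw , pw) = Balanced-Uses pw (closedWalk-balanced ts cw)

closedTrail⇒trail : ClosedTrail t ts es → es ↭ L → HasRBEulerTrail L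
closedTrail⇒trail (cw , pw) p = _ , _ , cw , _ , pw , p

trail⇒closedTrail : HasRBEulerTrail L → ∃[ t ] ∃[ ts ] ∃[ es ] (ClosedTrail t ts es × es ↭ L)
trail⇒closedTrail (t , ts , cw , es , pw , p) = t , ts , es , (cw , pw) , p

rotateWalk : ∀ xs {ys} → ClosedWalk s₁ (xs ++ s₂ ∷ ys) → ClosedWalk s₂ (ys ++ s₁ ∷ xs)
rotateWalk {s₁ = s₁} {s₂} xs {ys} cw
  with linked-split (s₁ ∷ xs) (subst (λ l → Linked NextStep (s₁ ∷ l)) (++-assoc xs (s₂ ∷ ys) [ s₁ ]) cw)
... | l₁ , l₂ = subst (λ l → Linked NextStep (s₂ ∷ l)) (sym (++-assoc ys (s₁ ∷ xs) [ s₂ ]))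
                  (linked-join (s₂ ∷ ys) l₂ l₁)

rotateTrail : ∀ xs {ys} → ClosedTrail s₁ (xs ++ s₂ ∷ ys) es →
              ∃[ es′ ] (ClosedTrail s₂ (ys ++ s₁ ∷ xs) es′ × es′ ↭ es)
rotateTrail xs (cw , u ∷ pw) with Pointwise-splitˡ xs pw
... | es₁ , f ∷ es₂ , refl , pw₁ , v ∷ pw₂ =
  f ∷ es₂ ++ _ ∷ es₁ , (rotateWalk xs cw , v ∷ Pointwise-++⁺ pw₂ (u ∷ pw₁)) , ++-comm (f ∷ es₂) (_ ∷ es₁)

startFrom : ClosedTrail t ts es → s ∈ₗ t ∷ ts → ∃[ ts′ ] ∃[ es′ ] (ClosedTrail s ts′ es′ × es′ ↭ es)
startFrom tr (here refl) = _ , _ , tr , ↭-refl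
startFrom tr (there s∈) with ∈-∃++ s∈
... | xs , ys , refl with rotateTrail xs tr
...   | es′ , tr′ , p = _ , es′ , tr′ , p

startFromEdge : ∀ {f} → ClosedTrail t ts es → f ∈ₗ es →
                ∃[ t′ ] ∃[ ts′ ] ∃[ es′ ] (ClosedTrail t′ ts′ (f ∷ es′) × f ∷ es′ ↭ es)
startFromEdge tr f∈ with ∈-∃++ f∈
startFromEdge tr@(_ , _ ∷ _) f∈ | [] , vs , refl = _ , _ , vs , tr , ↭-refl
startFromEdge tr@(cw , u ∷ pw) f∈ | w ∷ us , vs , refl with Pointwise-splitʳ us pw
... | T₁ , y ∷ T₂ , refl , pw₁ , v ∷ pw₂ =
  y , T₂ ++ _ ∷ T₁ , vs ++ w ∷ us ,
  (rotateWalk T₁ cw , v ∷ Pointwise-++⁺ pw₂ (u ∷ pw₁)) , ++-comm (_ ∷ vs) (w ∷ us)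

splice : ∀ {h₁ h₂ : CEdge k} {ts₁ ts₂ es₁ es₂} → ClosedTrail h₁ ts₁ es₁ → ClosedTrail h₂ ts₂ es₂ →
         start h₁ ≡ start h₂ → colour h₁ ≡ colour h₂ → ClosedTrail h₁ (ts₁ ++ h₂ ∷ ts₂) (es₁ ++ es₂)
splice {h₁ = c , x , y₁} {h₂ = .c , .x , y₂} {ts₁} {ts₂} (cw₁ , pw₁) (cw₂ , pw₂) refl refl =
  subst (λ l → Linked NextStep ((c , x , y₁) ∷ l)) (sym (++-assoc ts₁ ((c , x , y₂) ∷ ts₂) _))
    (linked-join ((c , x , y₁) ∷ ts₁)
      (linked-replaceLast ((c , x , y₁) ∷ ts₁) cw₁ λ {(_ , _ , _)} r → r)
      (linked-replaceLast ((c , x , y₂) ∷ ts₂) cw₂ λ {(_ , _ , _)} r → r)) ,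
  Pointwise-++⁺ pw₁ pw₂

-- Trails are balanced and connected

EdgeConnected : MG k → Set
EdgeConnected A = ∃[ r ] (∀ {e} → e ∈ₗ A → Conn A r (proj₁ e))

Eulerian : List (CEdge k) → Set
Eulerian L = (∃[ s ] s ∈ₗ L) × Balanced L × EdgeConnected (underlying L)

walk-reach : ∀ {A : MG k} {a} zs → Linked NextStep (a ∷ zs) →
             (∀ {s} → s ∈ₗ a ∷ zs → Conn A (start s) (end s)) →
             ∀ {s} → s ∈ₗ a ∷ zs → Conn A (start a) (start s)
walk-reach zs       l                steps (here refl) = here
walk-reach (b ∷ zs) ((refl , _) ∷ l) steps (there s∈)  =
  conn-trans (steps (here refl)) (walk-reach zs l (λ s∈′ → steps (there s∈′)) s∈)

∈-closedWalk : s ∈ₗ t ∷ ts ++ [ t ] → s ∈ₗ t ∷ ts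
∈-closedWalk (here refl) = here refl
∈-closedWalk {ts = ts} (there s∈) with ∈-++⁻ ts s∈
... | inj₁ s∈ts        = there s∈ts
... | inj₂ (here refl) = here refl

closedTrail-step : ClosedTrail t ts es → es ↭ L → s ∈ₗ t ∷ ts → Conn (underlying L) (start s) (end s)
closedTrail-step (_ , pw) p s∈ with Pointwise-∈ˡ pw s∈
... | ce , ce∈ , u = conn-edge (∈-map⁺ proj₂ (∈-resp-↭ p ce∈)) (Uses⇒HasEnds u)

closedTrail-reach : ClosedTrail t ts es → es ↭ L → s ∈ₗ t ∷ ts → Conn (underlying L) (start t) (start s)
closedTrail-reach {ts = ts} tr@(cw , _) p s∈ =
  walk-reach (ts ++ [ _ ]) cw (λ s∈′ → closedTrail-step tr p (∈-closedWalk s∈′)) (∈-++⁺ˡ s∈)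

closedTrail-connected : ClosedTrail t ts es → es ↭ L → EdgeConnected (underlying L)
closedTrail-connected {t = t} tr@(_ , pw) p = start t , connected
  where
  connected : ∀ {e} → e ∈ₗ underlying _ → Conn (underlying _) (start t) (proj₁ e)
  connected e∈ with ∈-map⁻ proj₂ e∈
  ... | ce , ce∈L , refl with Pointwise-∈ʳ pw (∈-resp-↭ (↭-sym p) ce∈L)
  ...   | s , s∈ , u with Uses⇒HasEnds u
  ...     | inj₁ (refl , _) = closedTrail-reach tr p s∈
  ...     | inj₂ (refl , _) = conn-trans (closedTrail-reach tr p s∈) (closedTrail-step tr p s∈)

trail⇒Eulerian : HasRBEulerTrail L → Eulerian L
trail⇒Eulerian h with trail⇒closedTrail h
... | _ , _ , e ∷ _ , tr , p =
  (e , ∈-resp-↭ p (here refl)) ,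
  Balanced-↭ p (closedTrail-balanced tr) ,
  closedTrail-connected tr p

-- Balanced connected edge lists have trails

otherColourAt : Balanced ((c , p , q) ∷ L) → 1 ≤ degᶜ (other c) L p
otherColourAt {c = c} {p = p} {q = q} {L = L} bal = subst (1 ≤_) (begin
  δ p p + δ q p + degᶜ c L p         ≡⟨ sym (degᶜ-here c (p , q) L p) ⟩
  degᶜ c ((c , p , q) ∷ L) p         ≡⟨ Balanced⇒colour bal c p ⟩
  degᶜ (other c) ((c , p , q) ∷ L) p ≡⟨ degᶜ-skip (p , q) L p (other-≢′ c) ⟩
  degᶜ (other c) L p                 ∎) (subst (λ n → 1 ≤ n + δ q p + degᶜ c L p) (sym (δ-refl p)) (s≤s z≤n))
  where open ≡-Reasoning

otherColourAt-after : ∀ {b : Edge k} {L′} → Balanced ((c , p , q) ∷ L) → L ↭ (other c , b) ∷ L′ →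
                      HasEnds b a p → a ≢ q → 1 ≤ degᶜ (other c) L′ q
otherColourAt-after {c = c} {p = p} {q = q} {L = L} {a = a} {b = b} {L′ = L′} bal L↭ h a≢q =
  subst (1 ≤_) (sym (+-cancelˡ-≡ (δ p q) _ _ (begin
    δ p q + degᶜ (other c) L′ q           ≡⟨ cong (λ n → n + δ p q + degᶜ (other c) L′ q) (sym (δ-≢ a≢q)) ⟩
    δ a q + δ p q + degᶜ (other c) L′ q   ≡⟨ cong (_+ degᶜ (other c) L′ q) (sym (endsAt-resp h q)) ⟩
    endsAt b q + degᶜ (other c) L′ q      ≡⟨ sym (degᶜ-here (other c) b L′ q) ⟩
    degᶜ (other c) ((other c , b) ∷ L′) q ≡⟨ sym (degᶜ-↭ (other c) L↭ q) ⟩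
    degᶜ (other c) L q                    ≡⟨ sym (degᶜ-skip (p , q) L q (other-≢′ c)) ⟩
    degᶜ (other c) ((c , p , q) ∷ L) q    ≡⟨ sym (Balanced⇒colour bal c q) ⟩
    degᶜ c ((c , p , q) ∷ L) q            ≡⟨ degᶜ-here c (p , q) L q ⟩
    δ p q + δ q q + degᶜ c L q            ≡⟨ cong (λ n → δ p q + n + degᶜ c L q) (δ-refl q) ⟩
    δ p q + 1 + degᶜ c L q                ≡⟨ +-assoc (δ p q) 1 _ ⟩
    δ p q + suc (degᶜ c L q)              ∎))) (s≤s z≤n)
  where open ≡-Reasoning

Balanced-contract : ∀ {c} {a p q d : Fin k} {b₁ b₂ L} → HasEnds b₁ a p → HasEnds b₂ q d →
  Balanced ((c , p , q) ∷ (other c , b₁) ∷ (other c , b₂) ∷ L) → Balanced ((other c , a , d) ∷ L)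
Balanced-contract {c = c} {a} {p} {q} {d} {b₁} {b₂} {L} h₁ h₂ bal = colour⇒Balanced c λ ℓ → begin
  degᶜ c ((c′ , a , d) ∷ L) ℓ  ≡⟨ degᶜ-skip (a , d) L ℓ (other-≢ c) ⟩
  degᶜ c L ℓ                   ≡⟨ +-cancelˡ-≡ (δ p ℓ + δ q ℓ) _ _ (balance ℓ) ⟩
  δ a ℓ + δ d ℓ + degᶜ c′ L ℓ  ≡⟨ sym (degᶜ-here c′ (a , d) L ℓ) ⟩
  degᶜ c′ ((c′ , a , d) ∷ L) ℓ ∎
  where
  open ≡-Reasoning
  c′ = other c
  shuffle : ∀ a p q d x → a + p + (q + d + x) ≡ p + q + (a + d + x)
  shuffle = solve-∀
  balance : ∀ ℓ → δ p ℓ + δ q ℓ + degᶜ c L ℓ ≡ δ p ℓ + δ q ℓ + (δ a ℓ + δ d ℓ + degᶜ c′ L ℓ)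
  balance ℓ = begin
    δ p ℓ + δ q ℓ + degᶜ c L ℓ
      ≡⟨ sym (trans (degᶜ-here c (p , q) _ ℓ)
               (cong (endsAt (p , q) ℓ +_) (trans (degᶜ-skip b₁ _ ℓ (other-≢ c)) (degᶜ-skip b₂ L ℓ (other-≢ c))))) ⟩
    degᶜ c ((c , p , q) ∷ (c′ , b₁) ∷ (c′ , b₂) ∷ L) ℓ
      ≡⟨ Balanced⇒colour bal c ℓ ⟩
    degᶜ c′ ((c , p , q) ∷ (c′ , b₁) ∷ (c′ , b₂) ∷ L) ℓ
      ≡⟨ trans (degᶜ-skip (p , q) _ ℓ (other-≢′ c))
           (trans (degᶜ-here c′ b₁ _ ℓ) (cong (endsAt b₁ ℓ +_) (degᶜ-here c′ b₂ L ℓ))) ⟩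
    endsAt b₁ ℓ + (endsAt b₂ ℓ + degᶜ c′ L ℓ)
      ≡⟨ cong₂ (λ m n → m + (n + degᶜ c′ L ℓ)) (endsAt-resp h₁ ℓ) (endsAt-resp h₂ ℓ) ⟩
    δ a ℓ + δ p ℓ + (δ q ℓ + δ d ℓ + degᶜ c′ L ℓ)
      ≡⟨ shuffle (δ a ℓ) (δ p ℓ) (δ q ℓ) (δ d ℓ) (degᶜ c′ L ℓ) ⟩
    δ p ℓ + δ q ℓ + (δ a ℓ + δ d ℓ + degᶜ c′ L ℓ) ∎

twoCycle : ∀ c (p q : Fin k) → ClosedWalk (c , p , q) [ (other c , q , p) ]
twoCycle c p q = (refl , other-≢′ c) ∷ (refl , other-≢ c) ∷ [-]

closedWalk-expand : ∀ {c} {a p q d : Fin k} ts → ClosedWalk (other c , a , d) ts →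
                    ClosedWalk (c , p , q) ((other c , q , d) ∷ ts ++ [ (other c , a , p) ])
closedWalk-expand {c = c} {a} {p} {q} {d} ts cw =
  rotateWalk [] {ys = (other c , q , d) ∷ ts}
    ((refl , other-≢ c) ∷ (refl , other-≢′ c) ∷ linked-replaceHead middle λ {(_ , _ , _)} r → r)
  where
  middle : Linked NextStep ((other c , a , d) ∷ ts ++ [ (other c , a , p) ])
  middle = linked-replaceLast ((other c , a , d) ∷ ts) cw λ {(_ , _ , _)} r → r

ClosedTrailFrom : CEdge k → List (CEdge k) → Set
ClosedTrailFrom t L = ∃[ ts ] ∃[ es ] ∃[ Rest ] (ClosedWalk t ts × Pointwise Uses ts es × L ↭ es ++ Rest)

ClosedTrailFrom-expand : ∀ {c} {a p q d : Fin k} {b₁ b₂ L L₂} →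
  L ↭ (other c , b₁) ∷ (other c , b₂) ∷ L₂ → HasEnds b₁ a p → HasEnds b₂ q d →
  ClosedTrailFrom (other c , a , d) L₂ → ClosedTrailFrom (c , p , q) L
ClosedTrailFrom-expand {c = c} {a} {p} {q} {d} {b₁} {b₂} {L} {L₂} L↭ h₁ h₂ (ts , es , Rest , cw , pw , L₂↭) =
  (other c , q , d) ∷ ts ++ [ (other c , a , p) ] , (other c , b₂) ∷ es ++ [ (other c , b₁) ] , Rest ,
  closedWalk-expand ts cw ,
  HasEnds⇒Uses h₂ ∷ Pointwise-++⁺ pw (HasEnds⇒Uses h₁ ∷ []) ,
  (begin
    L                                                   ↭⟨ L↭ ⟩
    (other c , b₁) ∷ (other c , b₂) ∷ L₂                ↭⟨ prep _ (prep _ L₂↭) ⟩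
    (other c , b₁) ∷ (other c , b₂) ∷ es ++ Rest        ↭⟨ swap _ _ ↭-refl ⟩
    (other c , b₂) ∷ (other c , b₁) ∷ es ++ Rest        ↭⟨ prep _ (↭-sym (shift _ es Rest)) ⟩
    (other c , b₂) ∷ es ++ (other c , b₁) ∷ Rest        ≡⟨ cong ((other c , b₂) ∷_) (sym (++-assoc es _ Rest)) ⟩
    ((other c , b₂) ∷ es ++ [ (other c , b₁) ]) ++ Rest ∎)
  where open PermutationReasoning

-- A closed walk is grown from the step (c , p , q).  It closes at once if an edge
-- {q,p} of the other colour c′ is available.  Otherwise the path a –b₁– p –c– q –b₂– d
-- with b₁, b₂ of colour c′ is contracted to a single step a – d of colour c′, which
-- keeps the list balanced, and the walk found for it is expanded again.
closedTrailFrom : ∀ n c (p q : Fin k) L → length L ≤ n → Balanced ((c , p , q) ∷ L) → ClosedTrailFrom (c , p , q) L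
closedTrailFrom zero c p q [] _ bal with () ← otherColourAt bal
closedTrailFrom (suc n) c p q L len bal with degᶜ-pos⇒↭ (other c) p L (otherColourAt bal)
... | b₁ , L₁ , L↭ , inc₁ with Incident⇒HasEnds inc₁
...   | a , h₁′ with HasEnds-sym h₁′ | a ≟ q
...     | h₁ | yes refl =
  [ (other c , q , p) ] , [ (other c , b₁) ] , L₁ ,
  twoCycle c p q , HasEnds⇒Uses h₁ ∷ [] , L↭
...     | h₁ | no a≢q with degᶜ-pos⇒↭ (other c) q L₁ (otherColourAt-after bal L↭ h₁ a≢q)
...       | b₂ , L₂ , L₁↭ , inc₂ with Incident⇒HasEnds inc₂ | ↭-trans L↭ (prep _ L₁↭)
...         | d , h₂ | L↭₂ =
  ClosedTrailFrom-expand L↭₂ h₁ h₂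
    (closedTrailFrom n (other c) a d L₂
      (≤-pred (≤-trans (n≤1+n _) (subst (_≤ suc n) (↭-length L↭₂) len)))
      (Balanced-contract h₁ h₂ (Balanced-↭ (prep _ L↭₂) bal)))

closedTrailAt : ∀ c {v} (f : CEdge k) R → Balanced (f ∷ R) → Incident (proj₂ f) v →
  ∃[ h ] ∃[ hs ] ∃[ es ] ∃[ Rest ] (ClosedTrail h hs es × start h ≡ v × colour h ≡ c × f ∷ R ↭ es ++ Rest)
closedTrailAt c (c′ , g) R bal inc with Incident⇒HasEnds inc | c′ ≟ᶜ c
... | w , h | yes refl with closedTrailFrom (length R) c _ w R ≤-refl (Balanced-reorient h bal)
...   | ts , es , Rest , cw , pw , R↭ =
  _ , ts , (c , g) ∷ es , Rest , (cw , HasEnds⇒Uses h ∷ pw) , refl , refl , prep _ R↭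
closedTrailAt c (c′ , g) R bal inc | w , h | no c′≢c
  with closedTrailFrom (length R) c′ w _ R ≤-refl (Balanced-reorient (HasEnds-sym h) bal)
... | [] , _ , _ , (_ , c′≢c′) ∷ [-] , _ = contradiction refl c′≢c′
... | y ∷ ys , es , Rest , cw@((refl , c′≢y) ∷ _) , pw , R↭
  with rotateTrail [] {ys = ys} (cw , HasEnds⇒Uses (HasEnds-sym h) ∷ pw)
...   | es′ , tr , es′↭ =
  y , ys ++ _ , es′ , Rest , tr , refl ,
  trans (≢⇒other (λ eq → c′≢y (sym eq))) (sym (≢⇒other (λ eq → c′≢c (sym eq)))) ,
  ↭-trans (prep _ R↭) (++⁺ʳ Rest (↭-sym es′↭))

Visited : List (CEdge k) → Fin k → Set
Visited T v = ∃[ s ] (s ∈ₗ T × start s ≡ v)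

closedTrail-visits : ∀ {ce} → ClosedTrail t ts es → ce ∈ₗ es → Incident (proj₂ ce) v → Visited (t ∷ ts) v
closedTrail-visits {t = t} {ts} (cw , pw) ce∈ inc with Pointwise-∈ʳ pw ce∈
... | s , s∈ , u with HasEnds-incident (Uses⇒HasEnds u) inc
...   | inj₁ refl = s , s∈ , refl
...   | inj₂ refl with linked-successor (t ∷ ts) cw s∈
...     | w , w∈ , (end≡start , _) = w , ∈-closedWalk w∈ , sym end≡start

findAttached : ∀ {E : List (CEdge k)} {x y g} → ClosedTrail t ts es → E ↭ es ++ Rest →
  Conn (underlying E) x y → Visited (t ∷ ts) x → g ∈ₗ Rest → Incident (proj₂ g) y →
  ∃[ f ] ∃[ s ] (f ∈ₗ Rest × s ∈ₗ t ∷ ts × Incident (proj₂ f) (start s))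
findAttached tr p here (s , s∈ , refl) g∈ inc = _ , s , g∈ , s∈ , inc
findAttached {es = es} tr p (step e e∈ h c) (s , s∈ , refl) g∈ inc with ∈-map⁻ proj₂ e∈
... | ce , ce∈E , refl with ∈-++⁻ es (∈-resp-↭ p ce∈E)
...   | inj₂ ce∈Rest = ce , s , ce∈Rest , s∈ , HasEnds⇒Incident h
...   | inj₁ ce∈es   = findAttached tr p c (closedTrail-visits tr ce∈es (HasEnds⇒Incident (HasEnds-sym h))) g∈ inc

-- By connectivity an unused edge f meets a vertex start s of the trail; a closed
-- trail through f that leaves this vertex with the colour of s is spliced in at s.
spliceAttached : ∀ {E : List (CEdge k)} {g} → Balanced E → EdgeConnected (underlying E) →
  ClosedTrail t ts es → E ↭ es ++ g ∷ Rest →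
  ∃[ t′ ] ∃[ ts′ ] ∃[ es′ ] ∃[ Rest′ ] (ClosedTrail t′ ts′ es′ × E ↭ es′ ++ Rest′ × length Rest′ ≤ length Rest)
spliceAttached {t = t} {es = es} {Rest} {E} {g} bal (r , toRoot) tr@(cw , u ∷ pw) p
  with findAttached tr p (conn-trans (conn-sym root→t) (toRoot (inE (∈-++⁺ʳ es (here refl)))))
         (_ , here refl , refl) (here refl) (inj₁ refl)
  where
  inE : ∀ {ce} → ce ∈ₗ es ++ g ∷ Rest → proj₂ ce ∈ₗ underlying E
  inE ce∈ = ∈-map⁺ proj₂ (∈-resp-↭ (↭-sym p) ce∈)
  root→t : Conn (underlying E) r (start t)
  root→t = conn-trans (toRoot (inE (here refl))) (conn-incident (inE (here refl)) (HasEnds⇒Incident (Uses⇒HasEnds u)))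
... | f , s , f∈ , s∈ , inc with ∈⇒↭ f∈
...   | R₁ , Rest↭
  with closedTrailAt (colour s) f R₁ (Balanced-↭ Rest↭ (Balanced-cancel p bal (closedTrail-balanced tr))) inc
...     | h , hs , e₂ ∷ es₂ , Rest₂ , tr₂ , start≡ , colour≡ , f∷R₁↭ with startFrom tr s∈
...       | ts′ , es′ , tr′ , es′↭ =
  s , ts′ ++ h ∷ hs , es′ ++ e₂ ∷ es₂ , Rest₂ , splice tr′ tr₂ (sym start≡) (sym colour≡) , perm , shorter
  where
  shorter : length Rest₂ ≤ length Rest
  shorter = ≤-pred (≤-trans (s≤s (m≤n+m _ (length es₂)))
              (≤-reflexive (sym (trans (↭-length (↭-trans Rest↭ f∷R₁↭)) (cong suc (length-++ es₂))))))
  perm : E ↭ (es′ ++ e₂ ∷ es₂) ++ Rest₂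
  perm = begin
    E                                ↭⟨ p ⟩
    es ++ g ∷ Rest                   ↭⟨ ++⁺ʳ _ (↭-sym es′↭) ⟩
    es′ ++ g ∷ Rest                  ↭⟨ ++⁺ˡ es′ (↭-trans Rest↭ f∷R₁↭) ⟩
    es′ ++ (e₂ ∷ es₂) ++ Rest₂       ≡⟨ sym (++-assoc es′ _ Rest₂) ⟩
    (es′ ++ e₂ ∷ es₂) ++ Rest₂       ∎
    where open PermutationReasoning

extendTrail : ∀ n {E : List (CEdge k)} Rest → length Rest ≤ n → Balanced E → EdgeConnected (underlying E) →
              ClosedTrail t ts es → E ↭ es ++ Rest → HasRBEulerTrail E
extendTrail n [] _ _ _ tr p = closedTrail⇒trail tr (↭-sym (↭-trans p (↭-reflexive (++-identityʳ _))))
extendTrail (suc n) (g ∷ Rest) len bal conn tr p with spliceAttached bal conn tr p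
... | _ , _ , _ , Rest′ , tr′ , p′ , shorter = extendTrail n Rest′ (≤-trans shorter (≤-pred len)) bal conn tr′ p′

eulerian⇒trail : ∀ {E : List (CEdge k)} → Eulerian E → HasRBEulerTrail E
eulerian⇒trail ((ce@(c , e) , ce∈) , bal , conn) with ∈⇒↭ ce∈
... | L , E↭ with closedTrailAt c ce L (Balanced-↭ E↭ bal) (inj₁ refl)
...   | _ , _ , _ , Rest , tr , _ , _ , ↭Rest =
  extendTrail (length Rest) Rest ≤-refl bal conn tr (↭-trans E↭ ↭Rest)

record EulerianPair (A M : MG k) : Set where
  constructor mkEulerianPair
  field
    nonEmpty  : ∃[ e ] e ∈ₗ A ++ M
    degrees   : ∀ ℓ → deg A ℓ ≡ deg M ℓ
    connected : EdgeConnected (A ++ M)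

Eulerian⇒EulerianPair : Eulerian (A ⊎MG M) → EulerianPair A M
Eulerian⇒EulerianPair {A = A} {M} ((ce , ce∈) , mkBalanced bal , conn) = mkEulerianPair
  (proj₂ ce , subst (proj₂ ce ∈ₗ_) (underlying-⊎MG A M) (∈-map⁺ proj₂ ce∈))
  (λ ℓ → trans (sym (degᶜ-red A M ℓ)) (trans (bal ℓ) (degᶜ-blue A M ℓ)))
  (subst EdgeConnected (underlying-⊎MG A M) conn)

EulerianPair⇒Eulerian : EulerianPair A M → Eulerian (A ⊎MG M)
EulerianPair⇒Eulerian {A = A} {M} (mkEulerianPair (e , e∈) degs conn) =
  nonEmpty (∈-++⁻ A e∈) ,
  mkBalanced (λ ℓ → trans (degᶜ-red A M ℓ) (trans (degs ℓ) (sym (degᶜ-blue A M ℓ)))) ,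
  subst EdgeConnected (sym (underlying-⊎MG A M)) conn
  where
  nonEmpty : e ∈ₗ A ⊎ e ∈ₗ M → ∃[ ce ] ce ∈ₗ A ⊎MG M
  nonEmpty (inj₁ e∈A) = _ , ∈-++⁺ˡ (∈-map⁺ (red ,_) e∈A)
  nonEmpty (inj₂ e∈M) = _ , ∈-++⁺ʳ (map (red ,_) A) (∈-map⁺ (blue ,_) e∈M)

trail⇒EulerianPair : HasRBEulerTrail (A ⊎MG M) → EulerianPair A M
trail⇒EulerianPair {A = A} {M} h = Eulerian⇒EulerianPair {A = A} {M} (trail⇒Eulerian h)

EulerianPair⇒trail : EulerianPair A M → HasRBEulerTrail (A ⊎MG M)
EulerianPair⇒trail h = eulerian⇒trail (EulerianPair⇒Eulerian h)

EulerianPair-transfer : EulerianPair A M → (∃[ e ] e ∈ₗ B ++ M′) →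
  (∀ ℓ → deg A ℓ ≡ deg M ℓ → deg B ℓ ≡ deg M′ ℓ) →
  (∀ {e} → e ∈ₗ A ++ M → Conn (B ++ M′) (proj₁ e) (proj₂ e)) →
  (∀ {e} → e ∈ₗ B ++ M′ → ∃[ e′ ] ∃[ u ] (e′ ∈ₗ A ++ M × Incident e′ u × Conn (B ++ M′) u (proj₁ e))) →
  EulerianPair B M′
EulerianPair-transfer {A = A} {M} {B} {M′} (mkEulerianPair _ degs (r , toRoot)) nonEmpty degs⇒ oldEdges newEdges =
  mkEulerianPair nonEmpty (λ ℓ → degs⇒ ℓ (degs ℓ)) (r , λ {e} e∈ → reach {e} (newEdges e∈))
  where
  reach : ∀ {e} → ∃[ e′ ] ∃[ u ] (e′ ∈ₗ A ++ M × Incident e′ u × Conn (B ++ M′) u (proj₁ e)) → Conn (B ++ M′) r (proj₁ e)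
  reach (e′ , u , e′∈ , inc , u→e) =
    conn-trans (conn-map oldEdges (conn-trans (toRoot e′∈) (conn-incident e′∈ inc))) u→e

≃-EulerianPair : A ≃ B → EulerianPair A M → EulerianPair B M
≃-EulerianPair {A = A} {B} {M} (degs , comps) ep@(mkEulerianPair (e₀ , e₀∈) _ _) =
  EulerianPair-transfer ep (nonEmpty (∈-++⁻ A e₀∈)) (λ ℓ → trans (sym (degs ℓ))) oldEdges newEdges
  where
  nonEmpty : e₀ ∈ₗ A ⊎ e₀ ∈ₗ M → ∃[ e ] e ∈ₗ B ++ M
  nonEmpty (inj₂ e₀∈M) = e₀ , ∈-++⁺ʳ B e₀∈M
  nonEmpty (inj₁ e₀∈A) with deg-pos⇒incident B _ (subst (1 ≤_) (degs _) (incident⇒deg-pos e₀∈A (inj₁ refl)))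
  ... | e , e∈B , _ = e , ∈-++⁺ˡ e∈B
  oldEdges : ∀ {e} → e ∈ₗ A ++ M → Conn (B ++ M) (proj₁ e) (proj₂ e)
  oldEdges {e} e∈ with ∈-++⁻ A e∈
  ... | inj₁ e∈A = conn-mono ∈-++⁺ˡ (proj₁ (comps _ _) (conn-edge e∈A (inj₁ (refl , refl))))
  ... | inj₂ e∈M = conn-edge (∈-++⁺ʳ B e∈M) (inj₁ (refl , refl))
  newEdges : ∀ {e} → e ∈ₗ B ++ M → ∃[ e′ ] ∃[ u ] (e′ ∈ₗ A ++ M × Incident e′ u × Conn (B ++ M) u (proj₁ e))
  newEdges {e} e∈ with ∈-++⁻ B e∈
  ... | inj₂ e∈M = e , _ , ∈-++⁺ʳ A e∈M , inj₁ refl , here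
  ... | inj₁ e∈B with deg-pos⇒incident A _ (subst (1 ≤_) (sym (degs _)) (incident⇒deg-pos e∈B (inj₁ refl)))
  ...   | e′ , e′∈A , inc = e′ , _ , ∈-++⁺ˡ e′∈A , inc , here

≃-trail : A ≃ B → HasRBEulerTrail (A ⊎MG M) → HasRBEulerTrail (B ⊎MG M)
≃-trail {A = A} {M = M} A≃B h = EulerianPair⇒trail (≃-EulerianPair A≃B (trail⇒EulerianPair {A = A} {M} h))

≋⇒≃ : A ≋ B → A ≃ B
≋⇒≃ A≋B = ≋⇒deg A≋B , λ x y → conn-map (edges A≋B) , conn-map (edges (≋-sym A≋B))
  where
  edges : ∀ {A B : MG k} → A ≋ B → ∀ {e} → e ∈ₗ A → Conn B (proj₁ e) (proj₂ e)
  edges A≋B e∈ with ≋-∈ A≋B e∈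
  ... | f , f∈ , h = conn-edge f∈ h

≋-trail : A ≋ B → HasRBEulerTrail (A ⊎MG M) → HasRBEulerTrail (B ⊎MG M)
≋-trail A≋B = ≃-trail (≋⇒≃ A≋B)

EulerianPair-subdivide : ∀ {e₁ e₂} → EulerianPair ((a , b) ∷ R) M → B ↭ e₁ ∷ e₂ ∷ R →
  HasEnds e₁ a i → HasEnds e₂ b j → EulerianPair B ((i , j) ∷ M)
EulerianPair-subdivide {a = a} {b} {R} {M} {B} {i} {j} {e₁} {e₂} ep B↭ h₁ h₂ =
  EulerianPair-transfer ep (e₁ , ∈-++⁺ˡ (inB (here refl))) degs⇒ oldEdges newEdges
  where
  Y = B ++ (i , j) ∷ M
  inB : ∀ {e} → e ∈ₗ e₁ ∷ e₂ ∷ R → e ∈ₗ B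
  inB = ∈-resp-↭ (↭-sym B↭)
  a→i : Conn Y a i
  a→i = conn-edge (∈-++⁺ˡ (inB (here refl))) h₁
  j→b : Conn Y j b
  j→b = conn-edge (∈-++⁺ˡ (inB (there (here refl)))) (HasEnds-sym h₂)
  i→j : Conn Y i j
  i→j = conn-edge (∈-++⁺ʳ B (here refl)) (inj₁ (refl , refl))
  degs⇒ : ∀ ℓ → deg ((a , b) ∷ R) ℓ ≡ deg M ℓ → deg B ℓ ≡ deg ((i , j) ∷ M) ℓ
  degs⇒ ℓ eq = begin
    deg B ℓ                                          ≡⟨ deg-↭ B↭ ℓ ⟩
    deg (e₁ ∷ e₂ ∷ R) ℓ                              ≡⟨ trans (deg-∷ e₁ (e₂ ∷ R) ℓ) (cong (endsAt e₁ ℓ +_) (deg-∷ e₂ R ℓ)) ⟩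
    endsAt e₁ ℓ + (endsAt e₂ ℓ + deg R ℓ)            ≡⟨ cong₂ (λ m n → m + (n + deg R ℓ)) (endsAt-resp h₁ ℓ) (endsAt-resp h₂ ℓ) ⟩
    δ a ℓ + δ i ℓ + (δ b ℓ + δ j ℓ + deg R ℓ)        ≡⟨ shuffle (δ a ℓ) (δ i ℓ) (δ b ℓ) (δ j ℓ) (deg R ℓ) ⟩
    δ i ℓ + δ j ℓ + (δ a ℓ + δ b ℓ + deg R ℓ)        ≡⟨ cong (δ i ℓ + δ j ℓ +_) (trans (sym (deg-∷ (a , b) R ℓ)) eq) ⟩
    δ i ℓ + δ j ℓ + deg M ℓ                          ≡⟨ sym (deg-∷ (i , j) M ℓ) ⟩
    deg ((i , j) ∷ M) ℓ                              ∎
    where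
    open ≡-Reasoning
    shuffle : ∀ a i b j r → a + i + (b + j + r) ≡ i + j + (a + b + r)
    shuffle = solve-∀
  oldEdges : ∀ {e} → e ∈ₗ (a , b) ∷ R ++ M → Conn Y (proj₁ e) (proj₂ e)
  oldEdges (here refl) = conn-trans a→i (conn-trans i→j j→b)
  oldEdges (there e∈) with ∈-++⁻ R e∈
  ... | inj₁ e∈R = conn-edge (∈-++⁺ˡ (inB (there (there e∈R)))) (inj₁ (refl , refl))
  ... | inj₂ e∈M = conn-edge (∈-++⁺ʳ B (there e∈M)) (inj₁ (refl , refl))
  newEdges : ∀ {e} → e ∈ₗ Y → ∃[ e′ ] ∃[ u ] (e′ ∈ₗ (a , b) ∷ R ++ M × Incident e′ u × Conn Y u (proj₁ e))
  newEdges {e} e∈ with ∈-++⁻ B e∈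
  ... | inj₂ (here refl) = (a , b) , a , here refl , inj₁ refl , a→i
  ... | inj₂ (there e∈M) = e , _ , ∈-++⁺ʳ ((a , b) ∷ R) e∈M , inj₁ refl , here
  ... | inj₁ e∈B with ∈-resp-↭ B↭ e∈B
  ...   | here refl = (a , b) , a , here refl , inj₁ refl ,
                      conn-sym (conn-incident (∈-++⁺ˡ e∈B) (HasEnds⇒Incident h₁))
  ...   | there (here refl) = (a , b) , b , here refl , inj₂ refl ,
                      conn-sym (conn-incident (∈-++⁺ˡ e∈B) (HasEnds⇒Incident h₂))
  ...   | there (there e∈R) = e , _ , there (∈-++⁺ˡ e∈R) , inj₁ refl , here

EulerianPair-blue-nonEmpty : ∀ {a b : Fin k} {R M} → EulerianPair ((a , b) ∷ R) M → ∃[ e ] e ∈ₗ M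
EulerianPair-blue-nonEmpty {a = a} {b} {R} {M} ep
  with deg-pos⇒incident M a
         (subst (1 ≤_) (EulerianPair.degrees ep a) (incident⇒deg-pos {A = (a , b) ∷ R} (here refl) (inj₁ refl)))
... | e , e∈M , _ = e , e∈M

PlusOne-contract : ∀ {g₁ gl : Edge k} {x y sl z₁} → A ↭ g₁ ∷ gl ∷ R →
  HasEnds gl sl x → HasEnds g₁ y z₁ → HasEnds (x , y) i j → PlusOne i j A ((sl , z₁) ∷ R)
PlusOne-contract A↭ hl h₁ (inj₁ (refl , refl)) =
  inj₂ (_ , _ , _ , _ , _ , ↭-trans A↭ (swap _ _ ↭-refl) , hl , HasEnds-sym h₁ , λ _ _ → refl)
PlusOne-contract {R = R} {sl = sl} {z₁} A↭ hl h₁ (inj₂ (refl , refl)) =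
  inj₂ (_ , _ , _ , _ , _ , A↭ , HasEnds-sym h₁ , hl , ≋⇒≈ (HasEnds⇒≋ {e = sl , z₁} {A = R} (inj₂ (refl , refl))))

closedWalk-contract : ∀ {y z₁ sl x : Fin k} mid →
  Linked NextStep ((red , y , z₁) ∷ mid ++ [ (red , sl , x) ]) → ClosedWalk (red , sl , z₁) mid
closedWalk-contract mid l =
  linked-replaceHead (linked-replaceLast ((red , _ , _) ∷ mid) l λ {(_ , _ , _)} r → r) λ {(_ , _ , _)} r → r

private
  ofColour-blue-head : ∀ {es : List (CEdge k)} → (blue , i , j) ∷ es ↭ A ⊎MG ((i , j) ∷ M) → ofColour blue es ↭ M
  ofColour-blue-head {A = A} p = drop-∷ (subst (_ ↭_) (ofColour-blue A _) (ofColour-↭ blue p))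

  ofColour-red-head : ∀ {es : List (CEdge k)} → (blue , i , j) ∷ es ↭ A ⊎MG ((i , j) ∷ M) → ofColour red es ↭ A
  ofColour-red-head {A = A} p = subst (_ ↭_) (ofColour-red A _) (ofColour-↭ red p)

contract-short : ∀ {x y : Fin k} {t₁ e₁} → NextStep (blue , x , y) t₁ → Uses t₁ e₁ →
                 (blue , i , j) ∷ e₁ ∷ [] ↭ A ⊎MG ((i , j) ∷ M) → M ≡ []
contract-short {t₁ = red  , _ , _} _ (refl , _) p = ↭-empty-inv (↭-sym (ofColour-blue-head p))
contract-short {t₁ = blue , _ , _} (_ , blue≢blue) _ _ = contradiction refl blue≢blue

-- The trail runs red sl → x, blue x → y, red y → z₁ around the blue edge {x,y} = {i,j};
-- these three steps are replaced by the single red step sl → z₁.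
contract-long : ∀ {x y : Fin k} {t₁ tl} mid {es} → ClosedWalk (blue , x , y) (t₁ ∷ mid ++ [ tl ]) →
  Pointwise Uses (t₁ ∷ mid ++ [ tl ]) es → HasEnds (x , y) i j → (blue , i , j) ∷ es ↭ A ⊎MG ((i , j) ∷ M) →
  ∃[ A′ ] (PlusOne i j A A′ × HasRBEulerTrail (A′ ⊎MG M))
contract-long {A = A} {M = M} {t₁ = c₁ , _ , z₁} {tl = cl , sl , _} mid {es = (_ , g₁) ∷ _}
              ((refl , blue≢c₁) ∷ cw) (u₁ ∷ pw) hxy perm
  with linked-split ((c₁ , _ , z₁) ∷ mid) (subst (λ l → Linked NextStep ((c₁ , _ , z₁) ∷ l)) (++-assoc mid _ _) cw)
     | Pointwise-splitˡ mid pw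
... | walk , (refl , cl≢blue) ∷ [-] | esm , (_ , gl) ∷ [] , refl , pwm , ul ∷ []
  with ≢⇒other {blue} (λ eq → blue≢c₁ (sym eq)) | ≢⇒other {blue} cl≢blue | u₁ | ul
... | refl | refl | refl , h₁ | refl , hl =
  (sl , z₁) ∷ ofColour red esm ,
  PlusOne-contract A↭ (Uses⇒HasEnds {s = red , sl , _} (refl , hl)) (Uses⇒HasEnds {s = red , _ , z₁} (refl , h₁)) hxy ,
  closedTrail⇒trail (closedWalk-contract mid walk , (refl , inj₁ (refl , refl)) ∷ pwm)
    (prep _ (↭-trans (↭-byColour esm) (⊎MG-↭ ↭-refl blue↭)))
  where
  blue↭ : ofColour blue esm ↭ M
  blue↭ = subst (_↭ M) (trans (ofColour-++ blue esm [ (red , gl) ]) (++-identityʳ _)) (ofColour-blue-head perm)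
  A↭ : A ↭ g₁ ∷ gl ∷ ofColour red esm
  A↭ = ↭-trans (↭-sym (subst (_↭ A) (cong (g₁ ∷_) (ofColour-++ red esm [ (red , gl) ])) (ofColour-red-head perm)))
               (prep g₁ (↭-sym (∷↭∷ʳ gl (ofColour red esm))))

-- Without an edge in M the trail could consist of the blue edge and one red edge.
contract-trail : (∃[ e ] e ∈ₗ M) → HasRBEulerTrail (A ⊎MG ((i , j) ∷ M)) →
                 ∃[ A′ ] (PlusOne i j A A′ × HasRBEulerTrail (A′ ⊎MG M))
contract-trail {M = M} {A = A} {i} {j} (_ , e∈M) h with trail⇒closedTrail h
... | _ , _ , _ , tr , es↭ with startFromEdge tr (∈-resp-↭ (↭-sym es↭) (∈-++⁺ʳ (map (red ,_) A) (here refl)))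
... | _ , []     , _ , ((_ , blue≢blue) ∷ [-] , _) , _ = contradiction refl blue≢blue
... | (_ , x , y) , t₁ ∷ rest , es′ , (cw , (refl , hxy) ∷ pw) , perm with initLast rest
...   | [] with pw | cw
...     | u₁ ∷ [] | r ∷ _ with contract-short {x = x} {y} r u₁ (↭-trans perm es↭)
...       | refl with e∈M
...         | ()
contract-trail _ _ | _ , _ , _ , _ , es↭ | _ , t₁ ∷ _ , _ , (cw , (refl , hxy) ∷ pw) , perm | mid ∷ʳ′ tl =
  contract-long mid cw pw hxy (↭-trans perm es↭)

⊆F-trans : 𝒜 ⊆F ℬ → ℬ ⊆F 𝒞 → 𝒜 ⊆F 𝒞
⊆F-trans 𝒜⊆ℬ ℬ⊆𝒞 A A∈ with 𝒜⊆ℬ A A∈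
... | B , B∈ , A≈B with ℬ⊆𝒞 B B∈
...   | C , C∈ , B≈C = C , C∈ , ≋⇒≈ (≋-trans (mk≋ {A = A} {B} A≈B) (mk≋ {A = B} {C} B≈C))

PlusOne-resp-≋ : A ≋ A′ → PlusOne i j A C → PlusOne i j A′ C
PlusOne-resp-≋ {A = A} {C = C} A≋A′ (inj₁ C≈A) = inj₁ (≋⇒≈ (≋-trans (mk≋ {A = C} {A} C≈A) A≋A′))
PlusOne-resp-≋ {C = C} A≋A′ (inj₂ (a , b , e₁ , e₂ , R , A↭ , h₁ , h₂ , C≈ab∷R))
  with ≋-uncons (≋-trans (≋-sym A≋A′) (↭⇒≋ A↭))
... | e₁′ , R₁ , A′↭ , h₁′ , R₁≋ with ≋-uncons R₁≋
...   | e₂′ , R₂ , R₁↭ , h₂′ , R₂≋R =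
  inj₂ (a , b , e₁′ , e₂′ , R₂ , ↭-trans A′↭ (prep e₁′ R₁↭) , HasEnds-trans h₁′ h₁ , HasEnds-trans h₂′ h₂ ,
        ≋⇒≈ (≋-trans (mk≋ {A = C} {(a , b) ∷ R} C≈ab∷R) (≋-∷ (a , b) (≋-sym R₂≋R))))

PlusOne-resp-≋ʳ : ∀ {i j : Fin k} {A C C′} → C′ ≋ C → PlusOne i j A C → PlusOne i j A C′
PlusOne-resp-≋ʳ {A = A} {C} C′≋C (inj₁ C≈A) = inj₁ (≋⇒≈ (≋-trans C′≋C (mk≋ {A = C} {A} C≈A)))
PlusOne-resp-≋ʳ {C = C} C′≋C (inj₂ (a , b , e₁ , e₂ , R , A↭ , h₁ , h₂ , C≈)) =
  inj₂ (a , b , e₁ , e₂ , R , A↭ , h₁ , h₂ , ≋⇒≈ (≋-trans C′≋C (mk≋ {A = C} {(a , b) ∷ R} C≈)))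

PlusF-⊆F : ∀ (i j : Fin k) → 𝒜 ⊆F ℬ → PlusF i j 𝒜 ⊆F PlusF i j ℬ
PlusF-⊆F i j 𝒜⊆ℬ C (A , A∈ , A↝C) with 𝒜⊆ℬ A A∈
... | B , B∈ , A≈B = C , (B , B∈ , PlusOne-resp-≋ {C = C} (mk≋ {A = A} {B} A≈B) A↝C) , ≋⇒≈ (≋-refl {A = C})

PlusIter-extensive : ∀ d {A} → 𝒜 A → PlusIter d i j 𝒜 A
PlusIter-extensive zero    A∈ = A∈
PlusIter-extensive (suc d) {A} A∈ = A , PlusIter-extensive d A∈ , inj₁ (≋⇒≈ (≋-refl {A = A}))

≲-trans : 𝒜 ≲ ℬ → ℬ ≲ 𝒞 → 𝒜 ≲ 𝒞
≲-trans 𝒜≲ℬ ℬ≲𝒞 M h = 𝒜≲ℬ M (ℬ≲𝒞 M h)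

≲-⊆F : 𝒜 ≲ ℬ → 𝒞 ⊆F ℬ → 𝒜 ≲ 𝒞
≲-⊆F 𝒜≲ℬ 𝒞⊆ℬ M (C , C∈ , tr) with 𝒞⊆ℬ C C∈
... | B , B∈ , C≈B = 𝒜≲ℬ M (B , B∈ , ≋-trail {M = M} (mk≋ {A = C} {B} C≈B) tr)

IsReduce⇒≲ : IsReduce 𝒜 ℬ → ℬ ≲ 𝒜
IsReduce⇒≲ (_ , represent , _) M (A , A∈ , tr) with represent A A∈
... | B , B∈ , A≃B = B , B∈ , ≃-trail {M = M} A≃B tr

PlusF-≲ : ∀ (i j : Fin k) → 𝒜 ≲ ℬ → PlusF i j 𝒜 ≲ PlusF i j ℬ
PlusF-≲ {𝒜 = 𝒜} i j 𝒜≲ℬ M (C , (B , B∈ , inj₁ C≈B) , tr) =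
  keep (𝒜≲ℬ M (B , B∈ , ≋-trail {M = M} (mk≋ {A = C} {B} C≈B) tr))
  where
  keep : ∃[ A ] (𝒜 A × HasRBEulerTrail (A ⊎MG M)) → ∃[ A′ ] (PlusF i j 𝒜 A′ × HasRBEulerTrail (A′ ⊎MG M))
  keep (A , A∈ , trA) = A , (A , A∈ , inj₁ (≋⇒≈ (≋-refl {A = A}))) , trA
PlusF-≲ {𝒜 = 𝒜} i j 𝒜≲ℬ M (C , (B , B∈ , inj₂ (a , b , e₁ , e₂ , R , B↭ , h₁ , h₂ , C≈ab∷R)) , tr) =
  contract (𝒜≲ℬ ((i , j) ∷ M) (B , B∈ , EulerianPair⇒trail (EulerianPair-subdivide {M = M} {B = B} ep B↭ h₁ h₂)))
  where
  ep : EulerianPair ((a , b) ∷ R) M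
  ep = trail⇒EulerianPair (≋-trail {M = M} (mk≋ {A = C} {(a , b) ∷ R} C≈ab∷R) tr)
  contract : ∃[ A ] (𝒜 A × HasRBEulerTrail (A ⊎MG ((i , j) ∷ M))) → ∃[ A′ ] (PlusF i j 𝒜 A′ × HasRBEulerTrail (A′ ⊎MG M))
  contract (A , A∈ , trA) = repackage (contract-trail {A = A} (EulerianPair-blue-nonEmpty ep) trA)
    where
    repackage : ∃[ A′ ] (PlusOne i j A A′ × HasRBEulerTrail (A′ ⊎MG M)) → ∃[ A′ ] (PlusF i j 𝒜 A′ × HasRBEulerTrail (A′ ⊎MG M))
    repackage (A′ , A↝A′ , trA′) = A′ , (A , A∈ , A↝A′) , trA′

reduceChain : ∀ {k} {i j : Fin k} {ℬ : Fam k} n (𝒜 : ℕ → Fam k) → 𝒜 0 ⊆F ℬ → 𝒜 0 ≲ ℬ →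
  (∀ q → suc q < n → IsReduce (PlusF i j (𝒜 q)) (𝒜 (suc q))) →
  ∀ q → q < n → (𝒜 q ⊆F PlusIter q i j ℬ) × (𝒜 q ≲ PlusIter q i j ℬ)
reduceChain n 𝒜 𝒜⊆ 𝒜≲ reduce zero    _  = 𝒜⊆ , 𝒜≲
reduceChain {i = i} {j} n 𝒜 𝒜⊆ 𝒜≲ reduce (suc q) sq<n with reduceChain n 𝒜 𝒜⊆ 𝒜≲ reduce q (<-trans (n<1+n q) sq<n)
... | 𝒜q⊆ , 𝒜q≲ = ⊆F-trans (proj₁ (reduce q sq<n)) (PlusF-⊆F i j 𝒜q⊆) ,
                 ≲-trans (IsReduce⇒≲ (reduce q sq<n)) (PlusF-≲ i j 𝒜q≲)

module _ {A : Set} where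

  final : A → List A → A
  final x []       = x
  final x (y ∷ ys) = final y ys

  last≡final : ∀ x xs → last (x ∷ xs) ≡ final x xs
  last≡final x []       = refl
  last≡final x (y ∷ ys) = trans (last-∷∷ ys) (last≡final y ys)
    where
    last-∷∷ : ∀ ys → last (x ∷ y ∷ ys) ≡ last (y ∷ ys)
    last-∷∷ ys with initLast ys
    ... | []        = refl
    ... | zs ∷ʳ′ z  = refl

  final-++ : ∀ x xs y ys → final x (xs ++ y ∷ ys) ≡ final y ys
  final-++ x []       y ys = refl
  final-++ x (z ∷ xs) y ys = final-++ z xs y ys

  final-∈ : ∀ x xs → final x xs ∈ₗ x ∷ xs
  final-∈ x []       = here refl
  final-∈ x (y ∷ ys) = there (final-∈ y ys)

  reverseOnto : A → List A → List A → List⁺ A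
  reverseOnto x []       acc = x ∷ acc
  reverseOnto x (y ∷ ys) acc = reverseOnto y ys (x ∷ acc)

  reverseOnto-↭ : ∀ x xs acc → toList (reverseOnto x xs acc) ↭ x ∷ xs ++ acc
  reverseOnto-↭ x []       acc = ↭-refl
  reverseOnto-↭ x (y ∷ ys) acc =
    ↭-trans (reverseOnto-↭ y ys (x ∷ acc)) (↭-trans (prep y (shift x ys acc)) (swap y x ↭-refl))

  reverseOnto-head : ∀ x xs acc → head (reverseOnto x xs acc) ≡ final x xs
  reverseOnto-head x []       acc = refl
  reverseOnto-head x (y ∷ ys) acc = reverseOnto-head y ys (x ∷ acc)

  reverseOnto-last : ∀ x xs acc → last (reverseOnto x xs acc) ≡ final x acc
  reverseOnto-last x []       acc = last≡final x acc
  reverseOnto-last x (y ∷ ys) acc = reverseOnto-last y ys (x ∷ acc)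

  module _ {R : A → A → Set} where

    reverseOnto-linked : (∀ {u v} → R u v → R v u) → ∀ x xs acc →
      Linked R (x ∷ xs) → Linked R (x ∷ acc) → Linked R (toList (reverseOnto x xs acc))
    reverseOnto-linked sym′ x []       acc l       l′ = l′
    reverseOnto-linked sym′ x (y ∷ ys) acc (r ∷ l) l′ = reverseOnto-linked sym′ y ys (x ∷ acc) l (sym′ r ∷ l′)

    linked-append : ∀ x xs {y ys} → Linked R (x ∷ xs) → R (final x xs) y → Linked R (y ∷ ys) →
                    Linked R (x ∷ xs ++ y ∷ ys)
    linked-append x []       l        r l′ = r ∷ l′
    linked-append x (z ∷ xs) (r₀ ∷ l) r l′ = r₀ ∷ linked-append z xs l r l′

  vertices : List (List⁺ A) → List A
  vertices ps = concat (map toList ps)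

  vertices-↭ : ∀ {ps ps′} → ps ↭ ps′ → vertices ps ↭ vertices ps′
  vertices-↭ refl           = ↭-refl
  vertices-↭ (prep P p)     = ++⁺ˡ (toList P) (vertices-↭ p)
  vertices-↭ (swap P Q p)   = ↭-trans (++⁺ˡ (toList P) (++⁺ˡ (toList Q) (vertices-↭ p))) (shifts (toList P) (toList Q))
  vertices-↭ (↭.trans p q)   = ↭-trans (vertices-↭ p) (vertices-↭ q)

  last-∈ : ∀ (P : List⁺ A) → last P ∈ₗ toList P
  last-∈ (x ∷ xs) = subst (_∈ₗ x ∷ xs) (sym (last≡final x xs)) (final-∈ x xs)

  last-⁺++⁺ : ∀ (P Q : List⁺ A) → last (P ⁺++⁺ Q) ≡ last Q
  last-⁺++⁺ (x ∷ xs) (y ∷ ys) =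
    trans (last≡final x (xs ++ y ∷ ys)) (trans (final-++ x xs y ys) (sym (last≡final y ys)))

  linked-⁺++⁺ : ∀ {R : A → A → Set} (P Q : List⁺ A) → Linked R (toList P) → R (last P) (head Q) →
                Linked R (toList Q) → Linked R (toList (P ⁺++⁺ Q))
  linked-⁺++⁺ {R} (x ∷ xs) (y ∷ ys) lP r lQ = linked-append x xs lP (subst (λ z → R z y) (last≡final x xs) r) lQ

edgeCount : ∀ {A : Set} → List (List⁺ A) → ℕ
edgeCount = sum ∘ map (length ∘ List⁺.tail)

edgeCount-↭ : ∀ {A : Set} {ps ps′ : List (List⁺ A)} → ps ↭ ps′ → edgeCount ps ≡ edgeCount ps′
edgeCount-↭ p = sum-↭ (map⁺ _ p)

length-vertices : ∀ {A : Set} (ps : List (List⁺ A)) → length (vertices ps) ≡ edgeCount ps + length ps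
length-vertices []              = refl
length-vertices ((x ∷ xs) ∷ ps) = begin
  suc (length (xs ++ vertices ps))          ≡⟨ cong suc (length-++ xs) ⟩
  suc (length xs + length (vertices ps))    ≡⟨ cong (λ n → suc (length xs + n)) (length-vertices ps) ⟩
  suc (length xs + (edgeCount ps + length ps)) ≡⟨ cong suc (sym (+-assoc (length xs) _ _)) ⟩
  suc (length xs + edgeCount ps + length ps) ≡⟨ sym (+-suc _ (length ps)) ⟩
  length xs + edgeCount ps + suc (length ps) ∎
  where open ≡-Reasoning

edgeCount-cut : ∀ {A : Set} (psA psB : List (List⁺ A)) x ys y zs →
  suc (edgeCount ((x ∷ ys) ∷ (y ∷ zs) ∷ psA ++ psB)) ≡ edgeCount (psA ++ (x ∷ ys ++ y ∷ zs) ∷ psB)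
edgeCount-cut psA psB x ys y zs = begin
  suc (length ys + (length zs + edgeCount (psA ++ psB))) ≡⟨ shuffle (length ys) (length zs) _ ⟩
  (length ys + suc (length zs)) + edgeCount (psA ++ psB) ≡⟨ cong (_+ edgeCount (psA ++ psB)) (sym (length-++ ys)) ⟩
  edgeCount ((x ∷ ys ++ y ∷ zs) ∷ psA ++ psB)          ≡⟨ edgeCount-↭ (↭-sym (shift _ psA psB)) ⟩
  edgeCount (psA ++ (x ∷ ys ++ y ∷ zs) ∷ psB)          ∎
  where
  open ≡-Reasoning
  shuffle : ∀ a b c → suc (a + (b + c)) ≡ (a + suc b) + c
  shuffle = solve-∀

module _ {k} (H : LGraph k) where

  private
    V = Fin (m H)

  LabelOK-resp : ∀ {P : List⁺ V} {f x y} → HasEnds f x y → LabelOK H P f → LabelOK H P (x , y)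
  LabelOK-resp (inj₁ (refl , refl)) ok                = ok
  LabelOK-resp (inj₂ (refl , refl)) (inj₁ (fh , fl)) = inj₂ (fl , fh)
  LabelOK-resp (inj₂ (refl , refl)) (inj₂ (fl , fh)) = inj₁ (fh , fl)

  orient : ∀ {P : List⁺ V} {x y} → IsPath H P → LabelOK H P (x , y) →
    ∃[ P′ ] (IsPath H P′ × toList P′ ↭ toList P × x ∈ lab H (head P′) × y ∈ lab H (last P′))
  orient {P} path (inj₁ (x∈ , y∈)) = P , path , ↭-refl , x∈ , y∈
  orient {p ∷ ps} {x} {y} path (inj₂ (x∈ , y∈)) =
    reverseOnto p ps [] ,
    reverseOnto-linked (E-sym H) p ps [] path [-] ,
    ↭-trans (reverseOnto-↭ p ps []) (↭-reflexive (cong (p ∷_) (++-identityʳ ps))) ,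
    subst (λ v → x ∈ lab H v) (trans (last≡final p ps) (sym (reverseOnto-head p ps []))) x∈ ,
    subst (λ v → y ∈ lab H v) (sym (reverseOnto-last p ps [])) y∈

  IsPathPacking-join : ∀ {i j : Fin k} → (∀ {u v} → u ≢ v → i ∈ lab H u → j ∈ lab H v → E H u v) →
    ∀ {P₁ P₂ ps a b} → IsPathPacking H (P₁ ∷ P₂ ∷ ps) → LabelOK H P₁ (a , i) → LabelOK H P₂ (j , b) →
    ∃[ J ] (IsPathPacking H (J ∷ ps) × LabelOK H J (a , b))
  IsPathPacking-join edge {P₁} {P₂} {ps} {b = b} (path₁ ∷ path₂ ∷ paths , ps↭) ok₁ ok₂
    with orient {P = P₁} path₁ ok₁ | orient {P = P₂} path₂ ok₂
  ... | Q₁ , pathQ₁ , Q₁↭ , a∈ , i∈ | Q₂ , pathQ₂ , Q₂↭ , j∈ , b∈ =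
    Q₁ ⁺++⁺ Q₂ , (pathJ ∷ paths , vertices↭) , inj₁ (a∈ , subst (λ v → b ∈ lab H v) (sym (last-⁺++⁺ Q₁ Q₂)) b∈)
    where
    split↭ : toList Q₁ ++ toList Q₂ ++ vertices ps ↭ allFin (m H)
    split↭ = ↭-trans (++⁺ Q₁↭ (++⁺ʳ (vertices ps) Q₂↭)) ps↭
    vertices↭ : vertices ((Q₁ ⁺++⁺ Q₂) ∷ ps) ↭ allFin (m H)
    vertices↭ = subst (_↭ allFin (m H))
      (trans (sym (++-assoc (toList Q₁) (toList Q₂) _)) (cong (_++ vertices ps) (toList-⁺++⁺ Q₁ Q₂))) split↭
    distinct : last Q₁ ≢ head Q₂
    distinct = Unique-++-≢ (toList Q₁) (Unique-↭ (↭-sym split↭) (allFin⁺ (m H))) (last-∈ Q₁) (here refl)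
    pathJ : IsPath H (Q₁ ⁺++⁺ Q₂)
    pathJ = linked-⁺++⁺ Q₁ Q₂ pathQ₁ (edge distinct i∈ j∈) pathQ₂

  pickLabel : ∀ {ps φ R} {e : Edge k} → IsLabelChoice H ps φ → φ ≋ e ∷ R →
    ∃[ P ] ∃[ ps′ ] ∃[ φ′ ] (ps ↭ P ∷ ps′ × LabelOK H P e × IsLabelChoice H ps′ φ′ × φ′ ≋ R)
  pickLabel lc φ≋ with ≋-uncons φ≋
  ... | f , φ′ , φ↭ , f∼e , φ′≋R with Pointwise-↭ lc φ↭
  ...   | P ∷ ps′ , ps↭ , ok ∷ lc′ = P , ps′ , φ′ , ps↭ , LabelOK-resp {P = P} f∼e ok , lc′ , φ′≋R

  Aux-join : ∀ {i j : Fin k} → (∀ {u v} → u ≢ v → i ∈ lab H u → j ∈ lab H v → E H u v) →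
    ∀ {A R e₁ e₂ a b} → Aux H A → A ≋ e₁ ∷ e₂ ∷ R → HasEnds e₁ a i → HasEnds e₂ b j → Aux H ((a , b) ∷ R)
  Aux-join edge {A} {R} {a = a} {b} (ps , (paths , ps↭) , φ , lc , φ≈A) A≋ h₁ h₂
    with pickLabel lc (≋-trans (mk≋ {A = φ} {A} φ≈A) A≋)
  ... | P₁ , ps₁ , φ₁ , ps↭₁ , ok₁ , lc₁ , φ₁≋ with pickLabel lc₁ φ₁≋
  ...   | P₂ , ps₂ , φ₂ , ps↭₂ , ok₂ , lc₂ , φ₂≋R
    with IsPathPacking-join edge
           (All-resp-↭ ps↭₁₂ paths , ↭-trans (vertices-↭ (↭-sym ps↭₁₂)) ps↭)
           (LabelOK-resp {P = P₁} h₁ ok₁) (LabelOK-resp {P = P₂} (HasEnds-sym h₂) ok₂)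
    where
    ps↭₁₂ : ps ↭ P₁ ∷ P₂ ∷ ps₂
    ps↭₁₂ = ↭-trans ps↭₁ (prep P₁ ps↭₂)
  ...     | J , packing , ok = J ∷ ps₂ , packing , (a , b) ∷ φ₂ , ok ∷ lc₂ , ≋⇒≈ (≋-∷ (a , b) φ₂≋R)

-- Plus-steps in η

PlusOne-split : ∀ {i j c d α γ : Fin k} {f R} → HasEnds (c , d) i j → HasEnds f α γ →
                PlusOne i j ((α , c) ∷ (d , γ) ∷ R) (f ∷ R)
PlusOne-split {α = α} {γ} {f} {R} (inj₁ (refl , refl)) f∼ =
  inj₂ (α , γ , _ , _ , R , ↭-refl , inj₁ (refl , refl) , inj₂ (refl , refl) , ≋⇒≈ (HasEnds⇒≋ f∼))
PlusOne-split {α = α} {γ} {f} {R} (inj₂ (refl , refl)) f∼ =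
  inj₂ (γ , α , _ , _ , R , swap _ _ ↭-refl , inj₂ (refl , refl) , inj₁ (refl , refl) ,
        ≋⇒≈ (HasEnds⇒≋ (HasEnds-sym f∼)))

module _ {k} (G : LGraph k) (i j : Fin k) where

  private
    Gx = η i j G
    V  = Fin (m G)

  Aux-η : ∀ {A} → Aux G A → Aux Gx A
  Aux-η (ps , (paths , ps↭) , φ , lc , φ≈A) = ps , (All-map (Linked-map inj₁) paths , ps↭) , φ , lc , φ≈A

  η-edge : ∀ {u v} → u ≢ v → i ∈ lab Gx u → j ∈ lab Gx v → E Gx u v
  η-edge u≢v i∈ j∈ = inj₂ (u≢v , inj₁ (i∈ , j∈))

  PlusIter⊆Aux-η : ∀ q → PlusIter q i j (Aux G) ⊆F Aux Gx
  PlusIter⊆Aux-η zero A A∈ = A , Aux-η {A} A∈ , ≋⇒≈ (≋-refl {A = A})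
  PlusIter⊆Aux-η (suc q) C (A , A∈ , A↝C) = joinStep (PlusIter⊆Aux-η q A A∈) A↝C
    where
    joinStep : ∃[ B ] (Aux Gx B × A ≈ B) → PlusOne i j A C → ∃[ B ] (Aux Gx B × C ≈ B)
    joinStep (B , B∈ , A≈B) (inj₁ C≈A) = B , B∈ , ≋⇒≈ (≋-trans (mk≋ {A = C} {A} C≈A) (mk≋ {A = A} {B} A≈B))
    joinStep (B , B∈ , A≈B) (inj₂ (a , b , e₁ , e₂ , R , A↭ , h₁ , h₂ , C≈ab∷R)) =
      (a , b) ∷ R , Aux-join Gx η-edge B∈ (≋-trans (≋-sym (mk≋ {A = A} {B} A≈B)) (↭⇒≋ A↭)) h₁ h₂ , C≈ab∷R

  CutLabels : V → V → Set
  CutLabels u v = ∃[ c ] ∃[ d ] (c ∈ lab G u × d ∈ lab G v × HasEnds (c , d) i j)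

  Split : V → List V → Set
  Split x xs = ∃[ ys ] ∃[ y ] ∃[ zs ]
    (xs ≡ ys ++ y ∷ zs × Linked (E Gx) (x ∷ ys) × Linked (E Gx) (y ∷ zs) × CutLabels (final x ys) y)

  splitPath : ∀ x xs → Linked (E Gx) (x ∷ xs) → Linked (E G) (x ∷ xs) ⊎ Split x xs
  splitPath x []       _ = inj₁ [-]
  splitPath x (y ∷ ys) (inj₂ (_ , inj₁ (i∈x , j∈y)) ∷ l) =
    inj₂ ([] , y , ys , refl , [-] , l , i , j , i∈x , j∈y , inj₁ (refl , refl))
  splitPath x (y ∷ ys) (inj₂ (_ , inj₂ (i∈y , j∈x)) ∷ l) =
    inj₂ ([] , y , ys , refl , [-] , l , j , i , j∈x , i∈y , inj₂ (refl , refl))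
  splitPath x (y ∷ ys) (inj₁ e ∷ l) with splitPath y ys l
  ... | inj₁ l′ = inj₁ (e ∷ l′)
  ... | inj₂ (ys′ , y′ , zs′ , refl , l₁ , l₂ , cl) = inj₂ (y ∷ ys′ , y′ , zs′ , refl , inj₁ e ∷ l₁ , l₂ , cl)

  Cuttable : List (List⁺ V) → Set
  Cuttable ps = ∃[ psA ] ∃[ x ] ∃[ ys ] ∃[ y ] ∃[ zs ] ∃[ psB ]
    (ps ≡ psA ++ (x ∷ ys ++ y ∷ zs) ∷ psB × Linked (E Gx) (x ∷ ys) × Linked (E Gx) (y ∷ zs) × CutLabels (final x ys) y)

  searchPaths : ∀ ps → All (IsPath Gx) ps → All (IsPath G) ps ⊎ Cuttable ps
  searchPaths []              []       = inj₁ []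
  searchPaths ((x ∷ xs) ∷ ps) (l ∷ ls) with splitPath x xs l
  ... | inj₂ (ys , y , zs , refl , split) = inj₂ ([] , x , ys , y , zs , ps , refl , split)
  ... | inj₁ lG with searchPaths ps ls
  ...   | inj₁ lsG = inj₁ (lG ∷ lsG)
  ...   | inj₂ (psA , x′ , ys , y , zs , psB , refl , split) =
    inj₂ ((x ∷ xs) ∷ psA , x′ , ys , y , zs , psB , refl , split)

  endpointLabels : ∀ {x ys y zs f} → LabelOK Gx (x ∷ ys ++ y ∷ zs) f →
    ∃[ α ] ∃[ γ ] (α ∈ lab G x × γ ∈ lab G (last (y ∷ zs)) × HasEnds f α γ)
  endpointLabels {x} {ys} {y} {zs} {f₁ , f₂} (inj₁ (f₁∈ , f₂∈)) =
    f₁ , f₂ , f₁∈ , subst (λ v → f₂ ∈ lab G v) (last-⁺++⁺ (x ∷ ys) (y ∷ zs)) f₂∈ , inj₁ (refl , refl)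
  endpointLabels {x} {ys} {y} {zs} {f₁ , f₂} (inj₂ (f₁∈ , f₂∈)) =
    f₂ , f₁ , f₂∈ , subst (λ v → f₁ ∈ lab G v) (last-⁺++⁺ (x ∷ ys) (y ∷ zs)) f₁∈ , inj₂ (refl , refl)

  cut : ∀ psA {x ys y zs} psB {φ} →
    IsPathPacking Gx (psA ++ (x ∷ ys ++ y ∷ zs) ∷ psB) → IsLabelChoice Gx (psA ++ (x ∷ ys ++ y ∷ zs) ∷ psB) φ →
    Linked (E Gx) (x ∷ ys) → Linked (E Gx) (y ∷ zs) → CutLabels (final x ys) y →
    ∃[ φ′ ] (IsPathPacking Gx ((x ∷ ys) ∷ (y ∷ zs) ∷ psA ++ psB) ×
             IsLabelChoice Gx ((x ∷ ys) ∷ (y ∷ zs) ∷ psA ++ psB) φ′ × PlusOne i j φ′ φ)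
  cut psA {x} {ys} {y} {zs} psB (paths , ps↭) lc l₁ l₂ (c , d , c∈ , d∈ , cd∼ij) with Pointwise-splitˡ psA lc
  ... | φA , f ∷ φB , refl , lcA , ok ∷ lcB with endpointLabels {x} {ys} {y} {zs} ok
  ...   | α , γ , α∈ , γ∈ , f∼αγ with All.++⁻ psA paths
  ...     | pathsA , _ ∷ pathsB =
    (α , c) ∷ (d , γ) ∷ φA ++ φB ,
    (l₁ ∷ l₂ ∷ All.++⁺ pathsA pathsB , vertices↭) ,
    inj₁ (α∈ , subst (λ v → c ∈ lab G v) (sym (last≡final x ys)) c∈) ∷ inj₁ (d∈ , γ∈) ∷ Pointwise-++⁺ lcA lcB ,
    PlusOne-resp-≋ʳ (↭⇒≋ (shift f φA φB)) (PlusOne-split cd∼ij f∼αγ)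
    where
    vertices↭ : vertices ((x ∷ ys) ∷ (y ∷ zs) ∷ psA ++ psB) ↭ allFin (m G)
    vertices↭ = ↭-trans (↭-reflexive (cong (x ∷_) (sym (++-assoc ys (y ∷ zs) _))))
                  (↭-trans (vertices-↭ (↭-sym (shift (x ∷ ys ++ y ∷ zs) psA psB))) ps↭)

  cutPaths : ∀ d ps {φ} → IsPathPacking Gx ps → IsLabelChoice Gx ps φ → edgeCount ps ≤ d →
             PlusIter d i j (Aux G) φ
  cutPaths d ps {φ} (paths , ps↭) lc bound with searchPaths ps paths
  ... | inj₁ pathsG = PlusIter-extensive d (ps , (pathsG , ps↭) , φ , lc , ≋⇒≈ (≋-refl {A = φ}))
  cutPaths zero _ (paths , ps↭) lc bound | inj₂ (psA , x , ys , y , zs , psB , refl , _)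
    with () ← subst (_≤ 0) (sym (edgeCount-cut psA psB x ys y zs)) bound
  cutPaths (suc d) _ packing lc bound | inj₂ (psA , x , ys , y , zs , psB , refl , l₁ , l₂ , cl)
    with cut psA psB packing lc l₁ l₂ cl
  ... | φ′ , packing′ , lc′ , φ′↝φ =
    φ′ , cutPaths d _ packing′ lc′ (≤-pred (subst (_≤ suc d) (sym (edgeCount-cut psA psB x ys y zs)) bound)) , φ′↝φ

  edgeCount-bound : ∀ {n ps} → 1 ≤ m G → m G ≤ n → vertices ps ↭ allFin (m G) → edgeCount ps ≤ n ∸ 1
  edgeCount-bound {n} {ps} 1≤m m≤n ps↭ with length-vertices ps | trans (↭-length ps↭) (length-tabulate {n = m G} (λ v → v))
  edgeCount-bound {n} {[]}     1≤m m≤n ps↭ | _  | len≡m with () ← subst (1 ≤_) (sym len≡m) 1≤m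
  edgeCount-bound {n} {P ∷ ps} 1≤m m≤n ps↭ | eq | len≡m =
    ≤-trans (m≤m+n (edgeCount (P ∷ ps)) (length ps))
      (∸-monoˡ-≤ 1 (subst (_≤ n) (trans (sym len≡m) eq′) m≤n))
    where
    eq′ : length (vertices (P ∷ ps)) ≡ suc (edgeCount (P ∷ ps) + length ps)
    eq′ = trans eq (+-suc _ _)

  Aux-η⊆PlusIter : ∀ {n} → 1 ≤ m G → m G ≤ n → Aux Gx ⊆F PlusIter (n ∸ 1) i j (Aux G)
  Aux-η⊆PlusIter 1≤m m≤n A (ps , packing@(_ , ps↭) , φ , lc , φ≈A) =
    φ , cutPaths _ ps packing lc (edgeCount-bound {ps = ps} 1≤m m≤n ps↭) , ≋⇒≈ (≋-sym (mk≋ {A = φ} {A} φ≈A))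

mainTheorem9 : (k n : ℕ) (i j : Fin k) → i ≢ j →
    (Gy : LGraph k) → 1 ≤ m Gy → m Gy ≤ n →
    (∀ v → ¬ (i ∈ lab Gy v × j ∈ lab Gy v)) →
    (PlusIter (n ∸ 1) i j (Aux Gy) ≡F Aux (η i j Gy)) ×
    ((𝒜 : ℕ → Fam k) →
      𝒜 0 ⊆F Aux Gy → 𝒜 0 ≲ Aux Gy →
      (∀ q → suc q < n → IsReduce (PlusF i j (𝒜 q)) (𝒜 (suc q))) →
      (𝒜 (n ∸ 1) ⊆F Aux (η i j Gy)) × (𝒜 (n ∸ 1) ≲ Aux (η i j Gy)))
mainTheorem9 k zero    i j _ Gy 1≤m m≤0 _ with () ← ≤-trans 1≤m m≤0
mainTheorem9 k (suc n) i j _ Gy 1≤m m≤n _ =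
  (PlusIter⊆Aux-η Gy i j n , Aux-η⊆PlusIter Gy i j 1≤m m≤n) ,
  λ 𝒜 𝒜⊆ 𝒜≲ reduce → let 𝒜n⊆ , 𝒜n≲ = reduceChain (suc n) 𝒜 𝒜⊆ 𝒜≲ reduce n (n<1+n n) in
    ⊆F-trans 𝒜n⊆ (PlusIter⊆Aux-η Gy i j n) , ≲-⊆F 𝒜n≲ (Aux-η⊆PlusIter Gy i j 1≤m m≤n)
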